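{- MEC restricted to instances whose input graph is a path on $n$ vertices can be solved (optimally) in $O(n^3)$ time.
   Context: A $C$-colored graph $G=(V,E,C)$ is a graph in which every vertex $v$ is assigned a color $c(v)$ from a set $C$. A connected component is colorful if no two of its vertices have the same color. If a graph has connected components with $n_1,\dots,n_t$ vertices, the number of edges in its transitive closure is $\sum_{i=1}^t n_i(n_i-1)/2$. Maximum Edges in transitive Closure (MEC): given a $C$-colored graph $G=(V,E,C)$, remove a set of edges $E'\subseteq E$ such that every connected component of $G'=(V,E\setminus E',C)$ is colorful and the number of edges in the transitive closure of $G'$ is maximized. -}

module Defs where

open import Data.Nat using (ℕ; zero; suc; _+_; _*_; _∸_; _^_; _≤_; _≡ᵇ_; _<ᵇ_)
open import Data.Bool using (Bool; true; false; not; if_then_else_)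
open import Data.Fin using (Fin; zero; suc; toℕ; fromℕ<) renaming (_<_ to _<ᶠ_)
open import Data.List using (List; []; _∷_; length; map; lookup)
open import Data.List.Membership.Propositional using (_∈_)
open import Data.List.Relation.Unary.Unique.Propositional using (Unique)
open import Data.Maybe using (Maybe; just; nothing)
open import Data.Product using (Σ; _×_; _,_; map₁; map₂)
open import Data.Nat.Properties using (_<?_)
open import Relation.Nullary using (yes; no)
open import Relation.Binary.PropositionalEquality using (_≡_)
open import Function.Bundles using (_⇔_)

record ColoredGraph : Set where
  field
    n     : ℕ
    edges : List (Fin n × Fin n)
    color : Fin n → ℕ
open ColoredGraph public

-- A set E' ⊆ E of removed edges: a mask on the edge positions
-- (true = the edge is removed).
RemovalSet : ColoredGraph → Set
RemovalSet G = Fin (length (edges G)) → Bool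

data Conn (G : ColoredGraph) (E' : RemovalSet G) : Fin (n G) → Fin (n G) → Set where
  conn-refl : ∀ u → Conn G E' u u
  conn-fwd  : ∀ (i : Fin (length (edges G))) → E' i ≡ false →
              Conn G E' (Data.Product.proj₁ (lookup (edges G) i))
                        (Data.Product.proj₂ (lookup (edges G) i))
  conn-bwd  : ∀ (i : Fin (length (edges G))) → E' i ≡ false →
              Conn G E' (Data.Product.proj₂ (lookup (edges G) i))
                        (Data.Product.proj₁ (lookup (edges G) i))
  conn-trans : ∀ {u v w} → Conn G E' u v → Conn G E' v w → Conn G E' u w

AllColorful : (G : ColoredGraph) → RemovalSet G → Set
AllColorful G E' = ∀ u v → Conn G E' u v → color G u ≡ color G v → u ≡ v

-- k is the number of edges in the transitive closure of G', i.e. the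
-- number of unordered pairs {u,v}, u ≠ v, lying in a common component.
TCSize : (G : ColoredGraph) → RemovalSet G → ℕ → Set
TCSize G E' k =
  Σ (List (Fin (n G) × Fin (n G))) λ L →
    Unique L ×
    (∀ u v → ((u , v) ∈ L) ⇔ ((u <ᶠ v) × Conn G E' u v)) ×
    length L ≡ k

OptimalMEC : (G : ColoredGraph) → RemovalSet G → Set
OptimalMEC G E' =
  AllColorful G E' ×
  (∀ (E'' : RemovalSet G) → AllColorful G E'' →
     ∀ k k'' → TCSize G E' k → TCSize G E'' k'' → k'' ≤ k)

-- Paths: vertices 0,1,…,n-1, edge number i joins i and i+1.

pathEdges : (n : ℕ) → List (Fin n × Fin n)
pathEdges zero = []
pathEdges (suc zero) = []
pathEdges (suc (suc k)) = (zero , suc zero) ∷ map (λ e → (suc (Data.Product.proj₁ e) , suc (Data.Product.proj₂ e))) (pathEdges (suc k))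

pathGraph : (n : ℕ) → (Fin n → ℕ) → ColoredGraph
pathGraph n c = record { n = n ; edges = pathEdges n ; color = c }

-- Cost model: a unit-cost RAM with unbounded natural-number memory,
-- addition, truncated subtraction, direct and indirect addressing.

Memory : Set
Memory = ℕ → ℕ

data Instr : Set where
  set   : (d k : ℕ) → Instr
  add   : (a b d : ℕ) → Instr
  sub   : (a b d : ℕ) → Instr
  load  : (a d : ℕ) → Instr
  store : (a s : ℕ) → Instr
  jz    : (a l : ℕ) → Instr
  jmp   : (l : ℕ) → Instr
  halt  : Instr

Program : Set
Program = List Instr

write : Memory → ℕ → ℕ → Memory
write M a v x = if x ≡ᵇ a then v else M x

fetch : Program → ℕ → Instr
fetch []       _       = halt
fetch (i ∷ _)  zero    = i
fetch (_ ∷ p)  (suc k) = fetch p k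

-- Execute from program counter pc with memory M for at most `fuel`
-- instructions (each instruction costs one step, halt included).
-- A program counter beyond the end of the program counts as halt.
run : Program → ℕ → ℕ → Memory → Maybe Memory
run P zero       pc M = nothing
run P (suc fuel) pc M with fetch P pc
... | set d k     = run P fuel (suc pc) (write M d k)
... | add a b d   = run P fuel (suc pc) (write M d (M a + M b))
... | sub a b d   = run P fuel (suc pc) (write M d (M a ∸ M b))
... | load a d    = run P fuel (suc pc) (write M d (M (M a)))
... | store a s   = run P fuel (suc pc) (write M (M a) (M s))
... | jz a l      = if M a ≡ᵇ 0 then run P fuel l M else run P fuel (suc pc) M
... | jmp l       = run P fuel l M
... | halt        = just M

-- Input encoding of a path instance: M[0] = n, M[1+i] = c(i) for i < n,
-- all other cells 0.
pathInput : (n : ℕ) → (Fin n → ℕ) → Memory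
pathInput n c zero = n
pathInput n c (suc i) with i <? n
... | yes i<n = c (fromℕ< i<n)
... | no  _   = 0

-- Output decoding: edge number i (joining vertices i and i+1) is removed
-- iff M[1+i] ≠ 0 in the final memory.
decodeRemovalFor : (n : ℕ) (c : Fin n → ℕ) → Memory → RemovalSet (pathGraph n c)
decodeRemovalFor n c M i = not (M (suc (toℕ i)) ≡ᵇ 0)

-- On a path the components left by removing edges are intervals, and an interval is colourful
-- iff no colour repeats in it. An optimal solution therefore cuts the path into colourful
-- intervals maximising the sum of pairs (length), which the dynamic program
--   best j = max { best i + pairs (j − i) | i < j, [i, j) colourful }
-- computes, together with back pointers to an optimal last split. For each j the splits
-- i = j − 1, j − 2, … are tried until the colour of i − 1 reappears in [i, j); each test costs
-- O(n), and the RAM program executing all this halts within 400 n³ + 400 steps.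

module Submission where

open import Defs
open import Data.Nat using (ℕ; suc; _+_; _*_; _^_)
open import Data.Fin using (Fin)
open import Data.Maybe using (just)
open import Data.Product using (Σ; _×_; _,_)
open import Relation.Binary.PropositionalEquality using (_≡_)

module Arithmetic where

  open import Data.Nat
  open import Data.Nat.Properties
  open import Data.Product using (_×_; _,_)
  open import Relation.Binary.PropositionalEquality

  ∸-suc : ∀ j i → i < j → j ∸ i ≡ suc (j ∸ suc i)
  ∸-suc (suc j) zero _ = refl
  ∸-suc (suc j) (suc i) (s≤s i<j) = ∸-suc j i i<j

  countdown : ∀ n i {m} → n ∸ i ≡ suc m → i < n × n ∸ suc i ≡ m
  countdown n i e = i<n , suc-injective (trans (sym (∸-suc n i i<n)) e)
    where i<n = m∸n≢0⇒n<m (λ n∸i≡0 → 1+n≢0 (trans (sym e) n∸i≡0))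

module Memories where

  open import Data.Nat
  open import Data.Nat.Properties
  open import Data.Bool using (true; false; T)
  open import Relation.Binary.PropositionalEquality
  open import Data.Empty using (⊥-elim)

  ≡ᵇ-true : ∀ m n → (m ≡ᵇ n) ≡ true → m ≡ n
  ≡ᵇ-true m n e = ≡ᵇ⇒≡ m n (subst T (sym e) _)

  ≡ᵇ-false : ∀ m n → (m ≡ᵇ n) ≡ false → m ≢ n
  ≡ᵇ-false m n e m≡n = subst T e (≡⇒≡ᵇ m n m≡n)

  write-≡ : ∀ M d v → write M d v d ≡ v
  write-≡ M d v with d ≡ᵇ d in eq
  ... | true = refl
  ... | false = ⊥-elim (≡ᵇ-false d d eq refl)

  write-≢ : ∀ M d v x → x ≢ d → write M d v x ≡ M x
  write-≢ M d v x x≢d with x ≡ᵇ d in eq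
  ... | true = ⊥-elim (x≢d (≡ᵇ-true x d eq))
  ... | false = refl

  write-< : ∀ M d v x → d < x → write M d v x ≡ M x
  write-< M d v x d<x = write-≢ M d v x (λ e → <-irrefl (sym e) d<x)

  write-> : ∀ M d v x → x < d → write M d v x ≡ M x
  write-> M d v x x<d = write-≢ M d v x (λ e → <-irrefl e x<d)

  write-at : ∀ {M d v x} → x ≡ d → write M d v x ≡ v
  write-at {M} {d} {v} refl = write-≡ M d v

-- A path on the vertices 0, 1, … with cut e = true iff the edge {e, e+1} is removed.
module Segments where

  open import Data.Nat
  open import Data.Nat.Properties
  open import Data.Bool using (Bool; true; false; if_then_else_)
  open import Data.Sum using (inj₁; inj₂)
  open import Data.Empty using (⊥-elim)
  open import Relation.Binary.PropositionalEquality
  open Arithmetic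

  pairs : ℕ → ℕ
  pairs zero = 0
  pairs (suc m) = pairs m + m

  segStart : (ℕ → Bool) → ℕ → ℕ
  segStart cut zero = 0
  segStart cut (suc v) = if cut v then suc v else segStart cut v

  -- The number of pairs u < v < j in a common segment.
  closure : (ℕ → Bool) → ℕ → ℕ
  closure cut zero = 0
  closure cut (suc v) = closure cut v + (v ∸ segStart cut v)

  segStart≤ : ∀ cut v → segStart cut v ≤ v
  segStart≤ cut zero = z≤n
  segStart≤ cut (suc v) with cut v
  ... | true = ≤-refl
  ... | false = m≤n⇒m≤1+n (segStart≤ cut v)

  segStart-same : ∀ cut v w → segStart cut w ≤ v → v ≤ w → segStart cut v ≡ segStart cut w
  segStart-same cut v zero _ z≤n = refl
  segStart-same cut v (suc w) s≤v v≤w with m≤n⇒m<n∨m≡n v≤w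
  ... | inj₂ refl = refl
  ... | inj₁ v<w with cut w
  ...   | true = ⊥-elim (<-irrefl refl (≤-trans v<w s≤v))
  ...   | false = segStart-same cut v w s≤v (≤-pred v<w)

  closure-segment : ∀ cut i j → (∀ v → i ≤ v → v < j → segStart cut v ≡ i) → i ≤ j →
                    closure cut j ≡ closure cut i + pairs (j ∸ i)
  closure-segment cut i zero h z≤n = sym (+-identityʳ _)
  closure-segment cut i (suc j) h i≤ with m≤n⇒m<n∨m≡n i≤
  ... | inj₂ refl = trans (sym (+-identityʳ _)) (cong (λ m → closure cut (suc j) + pairs m) (sym (n∸n≡0 (suc j))))
  ... | inj₁ i<j = begin
      closure cut j + (j ∸ segStart cut j)
        ≡⟨ cong₂ _+_ (closure-segment cut i j (λ v i≤v v<j → h v i≤v (m≤n⇒m≤1+n v<j)) (≤-pred i<j))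
                     (cong (j ∸_) (h j (≤-pred i<j) ≤-refl)) ⟩
      closure cut i + pairs (j ∸ i) + (j ∸ i)
        ≡⟨ +-assoc (closure cut i) _ _ ⟩
      closure cut i + pairs (suc (j ∸ i))
        ≡⟨ cong (λ m → closure cut i + pairs m) (sym (∸-suc (suc j) i i<j)) ⟩
      closure cut i + pairs (suc j ∸ i) ∎
    where open ≡-Reasoning

  segStart-after-cut : ∀ cut a v → cut a ≡ true → a < v → suc a ≤ segStart cut v
  segStart-after-cut cut a (suc v) e lt with m≤n⇒m<n∨m≡n (≤-pred lt)
  ... | inj₂ refl rewrite e = ≤-refl
  ... | inj₁ lt' with cut v
  ...   | true = s≤s (<⇒≤ lt')
  ...   | false = segStart-after-cut cut a v e lt'

  same-segStart⇒uncut : ∀ cut u v → u ≤ v → segStart cut u ≡ segStart cut v → ∀ e → u ≤ e → e < v → cut e ≡ false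
  same-segStart⇒uncut cut u v uv se e a b with cut e in eq
  ... | false = refl
  ... | true = ⊥-elim (<-irrefl refl (≤-trans (s≤s (≤-trans (segStart≤ cut u) a)) (≤-trans (segStart-after-cut cut e v eq b) (≤-reflexive (sym se)))))

  segStart-agree : ∀ c1 c2 j → (∀ e → suc e < j → c1 e ≡ c2 e) → ∀ v → v < j → segStart c1 v ≡ segStart c2 v
  segStart-agree c1 c2 j h zero _ = refl
  segStart-agree c1 c2 j h (suc v) lt rewrite h v lt | segStart-agree c1 c2 j h v (<-trans (n<1+n v) lt) = refl

  closure-agree : ∀ c1 c2 j → (∀ e → suc e < j → c1 e ≡ c2 e) → ∀ v → v ≤ j → closure c1 v ≡ closure c2 v
  closure-agree c1 c2 j h zero _ = refl
  closure-agree c1 c2 j h (suc v) le = cong₂ _+_ (closure-agree c1 c2 j h v (≤-trans (n≤1+n v) le)) (cong (v ∸_) (segStart-agree c1 c2 j h v le))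

module Algorithm (col : ℕ → ℕ) where

  open import Data.Nat
  open import Data.Bool using (Bool; true; false; if_then_else_)
  open import Data.Product using (_×_; _,_; proj₁; proj₂)

  -- Comparisons use only ∸ and tests against 0, as the RAM program performs them.
  dist : ℕ → ℕ → ℕ
  dist x y = (x ∸ y) + (y ∸ x)

  occurs : ℕ → ℕ → ℕ → Bool
  occurs x k zero = false
  occurs x k (suc m) = if dist x (col k) ≡ᵇ 0 then true else occurs x (suc k) m

  keepBest : ℕ → ℕ → ℕ → ℕ → ℕ × ℕ
  keepBest bj bk cand i = if (bj ∸ cand) ≡ᵇ 0 then (cand , i) else (bj , bk)

  -- scan bst j i tri len bj bk tries the last segments [i, j), [i-1, j), … while they stay
  -- colourful, with tri = pairs (j ∸ i) and len = j ∸ i; (bj, bk) is the best (value, split) so far.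
  scan : (ℕ → ℕ) → ℕ → ℕ → ℕ → ℕ → ℕ → ℕ → ℕ × ℕ
  scan bst j zero tri len bj bk = keepBest bj bk (bst zero + tri) zero
  scan bst j (suc i) tri len bj bk =
    if occurs (col i) (suc i) (j ∸ suc i)
      then keepBest bj bk (bst (suc i) + tri) (suc i)
      else scan bst j i (tri + len) (suc len)
             (proj₁ (keepBest bj bk (bst (suc i) + tri) (suc i)))
             (proj₂ (keepBest bj bk (bst (suc i) + tri) (suc i)))

  -- tables jj: the best values and back pointers, valid at the indices ≤ jj.
  tables : ℕ → Memory × Memory
  bestSplit : ℕ → ℕ × ℕ

  tables zero = (λ _ → 0) , (λ _ → 0)
  tables (suc jj) =
    write (proj₁ (tables jj)) (suc jj) (proj₁ (bestSplit jj)) ,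
    write (proj₂ (tables jj)) (suc jj) (proj₂ (bestSplit jj))

  bestSplit jj = scan (proj₁ (tables jj)) (suc jj) jj 0 1 0 0

  -- f is fuel; every split point on the back-pointer path from j gets the mark 1.
  reconstruct : Memory → ℕ → ℕ → Memory → Memory
  reconstruct bck zero j mk = mk
  reconstruct bck (suc f) zero mk = mk
  reconstruct bck (suc f) (suc j) mk = reconstruct bck f (bck (suc j)) (write mk (bck (suc j)) 1)

module Optimality (col : ℕ → ℕ) where

  open import Data.Nat
  open import Data.Nat.Properties
  open import Data.Bool using (Bool; true; false; not)
  open import Data.Product using (Σ; _×_; _,_; proj₁; proj₂)
  open import Data.Sum using (_⊎_; inj₁; inj₂)
  open import Data.Empty using (⊥; ⊥-elim)
  open import Relation.Nullary using (yes; no)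
  open import Relation.Binary.PropositionalEquality
  open Arithmetic
  open Memories
  open Segments
  open Algorithm col

  Colorful : ℕ → ℕ → Set
  Colorful a b = ∀ x y → a ≤ x → x < y → y < b → col x ≢ col y

  Feasible : (ℕ → Bool) → ℕ → Set
  Feasible cut j = ∀ a b → a < b → b < j → segStart cut a ≡ segStart cut b → col a ≢ col b

  dist≡0⇒≡ : ∀ x y → dist x y ≡ 0 → x ≡ y
  dist≡0⇒≡ x y e = ≤-antisym (m∸n≡0⇒m≤n (m+n≡0⇒m≡0 (x ∸ y) e)) (m∸n≡0⇒m≤n (m+n≡0⇒n≡0 (x ∸ y) e))

  occurs-false : ∀ x k m → occurs x k m ≡ false → ∀ y → k ≤ y → y < k + m → x ≢ col y
  occurs-false x k zero e y a b = ⊥-elim (<-irrefl refl (≤-trans (s≤s a) (≤-trans b (≤-reflexive (+-identityʳ k)))))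
  occurs-false x k (suc m) e y a b with dist x (col k) ≡ᵇ 0 in eq
  occurs-false x k (suc m) () y a b | true
  ... | false with m≤n⇒m<n∨m≡n a
  ...   | inj₂ refl = λ xe → ≡ᵇ-false _ _ eq (trans (cong (dist x) (sym xe)) (trans (cong (_+ (x ∸ x)) (n∸n≡0 x)) (n∸n≡0 x)))
  ...   | inj₁ lt = occurs-false x (suc k) m e y lt (≤-trans b (≤-reflexive (+-suc k m)))

  occurs-true : ∀ x k m → occurs x k m ≡ true → Σ ℕ λ y → k ≤ y × y < k + m × x ≡ col y
  occurs-true x k zero ()
  occurs-true x k (suc m) e with dist x (col k) ≡ᵇ 0 in eq
  ... | true = k , ≤-refl , m<m+n k (s≤s z≤n) , dist≡0⇒≡ _ _ (≡ᵇ-true _ _ eq)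
  ... | false with occurs-true x (suc k) m e
  ...   | y , a , b , c = y , ≤-trans (n≤1+n k) a , ≤-trans b (≤-reflexive (sym (+-suc k m))) , c

  colorful-extend : ∀ i j → Colorful (suc i) j → (∀ y → suc i ≤ y → y < j → col i ≢ col y) → Colorful i j
  colorful-extend i j cf h x y a b c with m≤n⇒m<n∨m≡n a
  ... | inj₂ refl = h y b c
  ... | inj₁ lt = cf x y lt b c

  keepBest-≥best : ∀ bj bk cand i → bj ≤ proj₁ (keepBest bj bk cand i)
  keepBest-≥best bj bk cand i with (bj ∸ cand) ≡ᵇ 0 in eq
  ... | true = m∸n≡0⇒m≤n (≡ᵇ-true _ _ eq)
  ... | false = ≤-refl

  keepBest-≥cand : ∀ bj bk cand i → cand ≤ proj₁ (keepBest bj bk cand i)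
  keepBest-≥cand bj bk cand i with (bj ∸ cand) ≡ᵇ 0 in eq
  ... | true = ≤-refl
  ... | false = ≰⇒≥ (λ le → ≡ᵇ-false _ _ eq (m≤n⇒m∸n≡0 le))

  scan-≥best : ∀ bst j i tri len bj bk → bj ≤ proj₁ (scan bst j i tri len bj bk)
  scan-≥best bst j zero tri len bj bk = keepBest-≥best bj bk (bst zero + tri) zero
  scan-≥best bst j (suc i) tri len bj bk with occurs (col i) (suc i) (j ∸ suc i)
  ... | true = keepBest-≥best bj bk (bst (suc i) + tri) (suc i)
  ... | false = ≤-trans (keepBest-≥best bj bk (bst (suc i) + tri) (suc i)) (scan-≥best bst j i _ _ _ _)

  pairs-step : ∀ j i tri len → suc i ≤ j → tri ≡ pairs (j ∸ suc i) → len ≡ j ∸ suc i → tri + len ≡ pairs (j ∸ i)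
  pairs-step j i tri len lt refl refl = cong pairs (sym (∸-suc j i lt))

  length-step : ∀ j i len → suc i ≤ j → len ≡ j ∸ suc i → suc len ≡ j ∸ i
  length-step j i len lt refl = sym (∸-suc j i lt)

  scan-≥split : ∀ bst j i tri len bj bk s → s ≤ i → i < j → tri ≡ pairs (j ∸ i) → len ≡ j ∸ i → Colorful s j →
        bst s + pairs (j ∸ s) ≤ proj₁ (scan bst j i tri len bj bk)
  scan-≥split bst j zero tri len bj bk .zero z≤n lt refl ln cf = keepBest-≥cand bj bk (bst zero + _) zero
  scan-≥split bst j (suc i) tri len bj bk s le lt tr ln cf with m≤n⇒m<n∨m≡n le
  ... | inj₂ refl rewrite tr with occurs (col i) (suc i) (j ∸ suc i)
  ...   | true = keepBest-≥cand bj bk (bst (suc i) + _) (suc i)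
  ...   | false = ≤-trans (keepBest-≥cand bj bk (bst (suc i) + _) (suc i)) (scan-≥best bst j i _ _ _ _)
  scan-≥split bst j (suc i) tri len bj bk s le lt tr ln cf | inj₁ slt with occurs (col i) (suc i) (j ∸ suc i) in eq
  ... | true = ⊥-elim (contra (occurs-true _ _ _ eq))
    where
      contra : (Σ ℕ λ y → suc i ≤ y × y < suc i + (j ∸ suc i) × col i ≡ col y) → ⊥
      contra (y , a , b , c) = cf i y (≤-pred slt) a (≤-trans b (≤-reflexive (m+[n∸m]≡n (<⇒≤ lt)))) c
  ... | false = scan-≥split bst j i _ _ _ _ s (≤-pred slt) (≤-trans (n≤1+n _) lt) (pairs-step j i tri len (<⇒≤ lt) tr ln) (length-step j i len (<⇒≤ lt) ln) cf

  GoodSplit : (ℕ → ℕ) → ℕ → ℕ × ℕ → Set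
  GoodSplit bst j (b , k) = (b ≡ bst k + pairs (j ∸ k)) × k < j × Colorful k j

  keepBest-good : ∀ bst j bj bk cand i → (bj ≡ 0 ⊎ GoodSplit bst j (bj , bk)) → cand ≡ bst i + pairs (j ∸ i) → i < j → Colorful i j →
              GoodSplit bst j (keepBest bj bk cand i)
  keepBest-good bst j bj bk cand i h ce lt cf with (bj ∸ cand) ≡ᵇ 0 in eq
  ... | true = ce , lt , cf
  ... | false with h
  ...   | inj₂ g = g
  ...   | inj₁ refl = ⊥-elim (≡ᵇ-false _ _ eq (0∸n≡0 cand))

  scan-good : ∀ bst j i tri len bj bk → i < j → tri ≡ pairs (j ∸ i) → len ≡ j ∸ i → Colorful i j →
          (bj ≡ 0 ⊎ GoodSplit bst j (bj , bk)) → GoodSplit bst j (scan bst j i tri len bj bk)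
  scan-good bst j zero tri len bj bk lt tr ln cf h = keepBest-good bst j bj bk _ zero h (cong (bst zero +_) tr) lt cf
  scan-good bst j (suc i) tri len bj bk lt tr ln cf h with occurs (col i) (suc i) (j ∸ suc i) in eq
  ... | true = keepBest-good bst j bj bk _ (suc i) h (cong (bst (suc i) +_) tr) lt cf
  ... | false = scan-good bst j i _ _ _ _ (≤-trans (n≤1+n _) lt) (pairs-step j i tri len (<⇒≤ lt) tr ln) (length-step j i len (<⇒≤ lt) ln)
                 (colorful-extend i j cf (λ y a b → occurs-false _ _ _ eq y a (≤-trans b (≤-reflexive (sym (m+[n∸m]≡n (<⇒≤ lt)))))))
                 (inj₂ (keepBest-good bst j bj bk _ (suc i) h (cong (bst (suc i) +_) tr) lt cf))

  best : ℕ → ℕ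
  best x = proj₁ (tables x) x

  back : ℕ → ℕ
  back x = proj₂ (tables x) x

  tables-best : ∀ jj x → x ≤ jj → proj₁ (tables jj) x ≡ best x
  tables-best zero .zero z≤n = refl
  tables-best (suc jj) x le with m≤n⇒m<n∨m≡n le
  ... | inj₂ refl = refl
  ... | inj₁ lt = trans (write-≢ (proj₁ (tables jj)) (suc jj) _ x (λ e → <-irrefl e lt)) (tables-best jj x (≤-pred lt))

  tables-back : ∀ jj x → x ≤ jj → proj₂ (tables jj) x ≡ back x
  tables-back zero .zero z≤n = refl
  tables-back (suc jj) x le with m≤n⇒m<n∨m≡n le
  ... | inj₂ refl = refl
  ... | inj₁ lt = trans (write-≢ (proj₂ (tables jj)) (suc jj) _ x (λ e → <-irrefl e lt)) (tables-back jj x (≤-pred lt))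

  colorful-singleton : ∀ j → Colorful j (suc j)
  colorful-singleton j x y a b c = ⊥-elim (<-irrefl refl (≤-trans c (≤-trans (s≤s a) b)))

  best-suc : ∀ jj → best (suc jj) ≡ proj₁ (bestSplit jj)
  best-suc jj = write-≡ (proj₁ (tables jj)) (suc jj) _

  back-suc : ∀ jj → back (suc jj) ≡ proj₂ (bestSplit jj)
  back-suc jj = write-≡ (proj₂ (tables jj)) (suc jj) _

  bestSplit-good : ∀ jj → GoodSplit (proj₁ (tables jj)) (suc jj) (bestSplit jj)
  bestSplit-good jj = scan-good (proj₁ (tables jj)) (suc jj) jj 0 1 0 0 ≤-refl
    (cong pairs (sym (m+n∸n≡m 1 jj))) (sym (m+n∸n≡m 1 jj)) (colorful-singleton jj) (inj₁ refl)

  best-good : ∀ jj → GoodSplit best (suc jj) (best (suc jj) , back (suc jj))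
  best-good jj rewrite best-suc jj | back-suc jj with bestSplit-good jj
  ... | value≡ , k<j , colorful =
    trans value≡ (cong (_+ pairs (suc jj ∸ proj₂ (bestSplit jj))) (tables-best jj _ (≤-pred k<j))) , k<j , colorful

  -- The last segment of a feasible cut is colourful, so scan tries its split point.
  closure≤best′ : ∀ f cut j → j ≤ f → Feasible cut j → closure cut j ≤ best j
  closure≤best′ f cut zero _ _ = z≤n
  closure≤best′ (suc f) cut (suc jj) (s≤s le) vp =
    begin
      closure cut (suc jj)
    ≡⟨ closure-segment cut t (suc jj) hs (≤-trans (segStart≤ cut jj) (n≤1+n jj)) ⟩
      closure cut t + pairs (suc jj ∸ t)
    ≤⟨ +-monoˡ-≤ _ (closure≤best′ f cut t (≤-trans (segStart≤ cut jj) le) (λ a b x y z → vp a b x (≤-trans y (≤-trans (segStart≤ cut jj) (n≤1+n jj))) z)) ⟩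
      best t + pairs (suc jj ∸ t)
    ≡⟨ cong (_+ pairs (suc jj ∸ t)) (sym (tables-best jj t (segStart≤ cut jj))) ⟩
      proj₁ (tables jj) t + pairs (suc jj ∸ t)
    ≤⟨ scan-≥split (proj₁ (tables jj)) (suc jj) jj 0 1 0 0 t (segStart≤ cut jj) ≤-refl (cong pairs (sym (m+n∸n≡m 1 jj))) (sym (m+n∸n≡m 1 jj)) cf ⟩
      proj₁ (bestSplit jj)
    ≡⟨ sym (write-≡ (proj₁ (tables jj)) (suc jj) _) ⟩
      best (suc jj)
    ∎
    where
      open ≤-Reasoning
      t = segStart cut jj
      hs : ∀ v → t ≤ v → v < suc jj → segStart cut v ≡ t
      hs v a b = segStart-same cut v jj a (≤-pred b)
      cf : Colorful t (suc jj)
      cf x y a b c = vp x y b c (trans (hs x a (<-trans b c)) (sym (hs y (≤-trans a (<⇒≤ b)) c)))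

  closure≤best : ∀ cut j → Feasible cut j → closure cut j ≤ best j
  closure≤best cut j = closure≤best′ j cut j ≤-refl

  -- A mark on vertex e + 1 cuts the edge {e, e + 1}, as in decodeRemovalFor.
  cutsOf : (ℕ → ℕ) → ℕ → Bool
  cutsOf mk e = not (mk (suc e) ≡ᵇ 0)

  segStart-constant : ∀ cut i j → segStart cut i ≡ i → (∀ e → i ≤ e → suc e < j → cut e ≡ false) → ∀ v → i ≤ v → v < j → segStart cut v ≡ i
  segStart-constant cut i j s0 h v a b with m≤n⇒m<n∨m≡n a
  ... | inj₂ refl = s0
  segStart-constant cut i j s0 h (suc v) a b | inj₁ lt rewrite h v (≤-pred lt) b = segStart-constant cut i j s0 h v (≤-pred lt) (≤-trans (n≤1+n _) b)

  segStart-self : ∀ mk i → (i ≡ 0 ⊎ mk i ≡ 1) → segStart (cutsOf mk) i ≡ i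
  segStart-self mk zero _ = refl
  segStart-self mk (suc i) (inj₂ e) rewrite e = refl

  module Reconstruction (N : ℕ) where
    bck : ℕ → ℕ
    bck = proj₂ (tables N)

    reconstruct-correct : ∀ f j mk0 → j ≤ f → j ≤ N → (∀ x → 1 ≤ x → x < j → mk0 x ≡ 0) →
      (∀ x → j ≤ x → reconstruct bck f j mk0 x ≡ mk0 x) ×
      (closure (cutsOf (reconstruct bck f j mk0)) j ≡ best j) ×
      Feasible (cutsOf (reconstruct bck f j mk0)) j
    reconstruct-correct zero zero mk0 _ _ _ = (λ x _ → refl) , refl , (λ a b _ ())
    reconstruct-correct (suc f) zero mk0 _ _ _ = (λ x _ → refl) , refl , (λ a b _ ())
    reconstruct-correct (suc f) (suc j) mk0 (s≤s le) jN z0 = pA , pB , pC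
      where
        i = bck (suc j)
        ie : i ≡ back (suc j)
        ie = tables-back N (suc j) jN
        gd = best-good j
        i<j : i < suc j
        i<j = subst (_< suc j) (sym ie) (proj₁ (proj₂ gd))
        mk1 = write mk0 i 1
        z1 : ∀ x → 1 ≤ x → x < i → mk1 x ≡ 0
        z1 x a b = trans (write-≢ mk0 i 1 x (λ e → <-irrefl e b)) (z0 x a (<-trans b i<j))
        IH = reconstruct-correct f i mk1 (≤-pred (≤-trans i<j (s≤s le))) (≤-trans (<⇒≤ i<j) jN) z1
        mkF = reconstruct bck f i mk1
        cut = cutsOf mkF
        pA : ∀ x → suc j ≤ x → mkF x ≡ mk0 x
        pA x a = trans (proj₁ IH x (≤-trans (<⇒≤ i<j) a)) (write-≢ mk0 i 1 x (λ e → <-irrefl (sym e) (≤-trans i<j a)))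
        mkFi : mkF i ≡ 1
        mkFi = trans (proj₁ IH i ≤-refl) (write-≡ mk0 i 1)
        s0 : segStart cut i ≡ i
        s0 = segStart-self mkF i (case i refl)
          where case : ∀ k → k ≡ i → k ≡ 0 ⊎ mkF k ≡ 1
                case zero _ = inj₁ refl
                case (suc k) e = inj₂ (trans (cong mkF e) mkFi)
        uncut : ∀ e → i ≤ e → suc e < suc j → cut e ≡ false
        uncut e a b rewrite proj₁ IH (suc e) (≤-trans a (n≤1+n e))
                          | write-≢ mk0 i 1 (suc e) (λ q → <-irrefl (sym q) (s≤s a))
                          | z0 (suc e) (s≤s z≤n) b = refl
        segs : ∀ v → i ≤ v → v < suc j → segStart cut v ≡ i
        segs = segStart-constant cut i (suc j) s0 uncut
        pB : closure cut (suc j) ≡ best (suc j)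
        pB = begin
            closure cut (suc j)
          ≡⟨ closure-segment cut i (suc j) segs (<⇒≤ i<j) ⟩
            closure cut i + pairs (suc j ∸ i)
          ≡⟨ cong (_+ pairs (suc j ∸ i)) (proj₁ (proj₂ IH)) ⟩
            best i + pairs (suc j ∸ i)
          ≡⟨ cong (λ z → best z + pairs (suc j ∸ z)) ie ⟩
            best (back (suc j)) + pairs (suc j ∸ back (suc j))
          ≡⟨ sym (proj₁ gd) ⟩
            best (suc j)
          ∎
          where open ≡-Reasoning
        pC : Feasible cut (suc j)
        pC a b ab bj se with b <? i
        ... | yes bi = proj₂ (proj₂ IH) a b ab bi se
        ... | no bi with a <? i
        ...   | yes ai = ⊥-elim (<-irrefl refl (≤-trans (s≤s (segStart≤ cut a)) (≤-trans ai (≤-reflexive (trans (sym (segs b (≮⇒≥ bi) bj)) (sym se))))))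
        ...   | no ai = proj₂ (proj₂ gd) a b (subst (_≤ a) ie (≮⇒≥ ai)) ab bj

module Counting where

  open import Data.Nat
  open import Data.Nat.Properties
  open import Data.Bool using (Bool)
  open import Data.Product using (_×_; _,_; proj₁; proj₂)
  open import Data.Sum using (inj₁; inj₂)
  open import Data.Empty using (⊥-elim)
  open import Data.List using (List; []; _∷_; _++_; map; length)
  open import Data.List.Properties using (length-map; length-++)
  open import Data.List.Membership.Propositional using (_∈_)
  open import Data.List.Membership.Propositional.Properties using (∈-∃++; ∈-map⁺; ∈-map⁻; ∈-++⁺ˡ; ∈-++⁺ʳ; ∈-++⁻)
  open import Data.List.Relation.Unary.Any using (here; there)
  open import Data.List.Relation.Unary.All using (All; []; _∷_)
  import Data.List.Relation.Unary.All as All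
  open import Data.List.Relation.Unary.AllPairs using ([]; _∷_)
  open import Data.List.Relation.Unary.Unique.Propositional using (Unique)
  import Data.List.Relation.Unary.Unique.Propositional.Properties as UP
  open import Data.List.Relation.Binary.Subset.Propositional using (_⊆_)
  open import Relation.Binary.PropositionalEquality
  open import Relation.Nullary using (¬_)
  open Segments

  module _ {A : Set} where
    ⊆-remove : ∀ (x : A) xs us vs → All (x ≢_) xs → xs ⊆ (us ++ x ∷ vs) → xs ⊆ (us ++ vs)
    ⊆-remove x xs us vs nx sb {y} y∈ with ∈-++⁻ us (sb y∈)
    ... | inj₁ p = ∈-++⁺ˡ p
    ... | inj₂ (here refl) = ⊥-elim (All.lookup nx y∈ refl)
    ... | inj₂ (there p) = ∈-++⁺ʳ us p

    Unique-⊆⇒length≤ : ∀ (xs ys : List A) → Unique xs → xs ⊆ ys → length xs ≤ length ys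
    Unique-⊆⇒length≤ [] ys _ _ = z≤n
    Unique-⊆⇒length≤ (x ∷ xs) ys (nx ∷ u) sb with ∈-∃++ (sb (here refl))
    ... | us , vs , refl = ≤-trans (s≤s (Unique-⊆⇒length≤ xs (us ++ vs) u (⊆-remove x xs us vs nx (λ p → sb (there p)))))
                             (≤-reflexive (trans (cong suc (length-++ us)) (trans (sym (+-suc (length us) (length vs))) (sym (length-++ us)))))

  interval : ℕ → ℕ → List ℕ
  interval a zero = []
  interval a (suc m) = a ∷ interval (suc a) m

  interval-length : ∀ a m → length (interval a m) ≡ m
  interval-length a zero = refl
  interval-length a (suc m) = cong suc (interval-length (suc a) m)

  ∈-interval⁻ : ∀ a m x → x ∈ interval a m → a ≤ x × x < a + m
  ∈-interval⁻ a zero x ()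
  ∈-interval⁻ a (suc m) x (here refl) = ≤-refl , m<m+n a (s≤s z≤n)
  ∈-interval⁻ a (suc m) x (there p) with ∈-interval⁻ (suc a) m x p
  ... | b , c = ≤-trans (n≤1+n a) b , ≤-trans c (≤-reflexive (sym (+-suc a m)))

  ∈-interval⁺ : ∀ a m x → a ≤ x → x < a + m → x ∈ interval a m
  ∈-interval⁺ a zero x b c = ⊥-elim (<-irrefl refl (≤-trans (s≤s b) (≤-trans c (≤-reflexive (+-identityʳ a)))))
  ∈-interval⁺ a (suc m) x b c with m≤n⇒m<n∨m≡n b
  ... | inj₂ refl = here refl
  ... | inj₁ lt = there (∈-interval⁺ (suc a) m x lt (≤-trans c (≤-reflexive (+-suc a m))))

  interval-unique : ∀ a m → Unique (interval a m)
  interval-unique a zero = []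
  interval-unique a (suc m) = All.tabulate (λ {x} p e → <-irrefl e (proj₁ (∈-interval⁻ (suc a) m x p))) ∷ interval-unique (suc a) m

  row : (ℕ → Bool) → ℕ → List (ℕ × ℕ)
  row cut v = map (λ u → (u , v)) (interval (segStart cut v) (v ∸ segStart cut v))

  closurePairs : (ℕ → Bool) → ℕ → List (ℕ × ℕ)
  closurePairs cut zero = []
  closurePairs cut (suc v) = closurePairs cut v ++ row cut v

  closurePairs-length : ∀ cut j → length (closurePairs cut j) ≡ closure cut j
  closurePairs-length cut zero = refl
  closurePairs-length cut (suc v) = begin
    length (closurePairs cut v ++ row cut v)          ≡⟨ length-++ (closurePairs cut v) ⟩
    length (closurePairs cut v) + length (row cut v)  ≡⟨ cong₂ _+_ (closurePairs-length cut v) row-length ⟩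
    closure cut v + (v ∸ segStart cut v)              ∎
    where
      open ≡-Reasoning
      row-length : length (row cut v) ≡ v ∸ segStart cut v
      row-length = trans (length-map (λ u → (u , v)) (interval (segStart cut v) (v ∸ segStart cut v))) (interval-length _ _)

  ∈-closurePairs⁻ : ∀ cut j a b → (a , b) ∈ closurePairs cut j → a < b × b < j × segStart cut a ≡ segStart cut b
  ∈-closurePairs⁻ cut zero a b ()
  ∈-closurePairs⁻ cut (suc v) a b p with ∈-++⁻ (closurePairs cut v) p
  ... | inj₁ q with ∈-closurePairs⁻ cut v a b q
  ...   | x , y , z = x , ≤-trans y (n≤1+n v) , z
  ∈-closurePairs⁻ cut (suc v) a b p | inj₂ q with ∈-map⁻ (λ u → (u , v)) q
  ... | u , u∈ , refl with ∈-interval⁻ _ _ u u∈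
  ...   | x , y = ≤-trans y (≤-reflexive (m+[n∸m]≡n (segStart≤ cut v))) , ≤-refl , segStart-same cut u v x (≤-trans (n≤1+n u) (≤-trans y (≤-reflexive (m+[n∸m]≡n (segStart≤ cut v)))))

  ∈-closurePairs⁺ : ∀ cut j a b → a < b → b < j → segStart cut a ≡ segStart cut b → (a , b) ∈ closurePairs cut j
  ∈-closurePairs⁺ cut zero a b ab () se
  ∈-closurePairs⁺ cut (suc v) a b ab bj se with m≤n⇒m<n∨m≡n (≤-pred bj)
  ... | inj₁ lt = ∈-++⁺ˡ (∈-closurePairs⁺ cut v a b ab lt se)
  ... | inj₂ refl = ∈-++⁺ʳ (closurePairs cut b) (∈-map⁺ (λ u → (u , b)) (∈-interval⁺ _ _ a (subst (_≤ a) se (segStart≤ cut a))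
                       (≤-trans ab (≤-reflexive (sym (m+[n∸m]≡n (segStart≤ cut b)))))))

  closurePairs-unique : ∀ cut j → Unique (closurePairs cut j)
  closurePairs-unique cut zero = []
  closurePairs-unique cut (suc v) = UP.++⁺ (closurePairs-unique cut v) (UP.map⁺ inj (interval-unique _ _)) disj
    where
      inj : ∀ {x y} → (x , v) ≡ (y , v) → x ≡ y
      inj refl = refl
      disj : ∀ {p} → ¬ (p ∈ closurePairs cut v × p ∈ row cut v)
      disj {a , b} (p1 , p2) with ∈-map⁻ (λ u → (u , v)) p2
      ... | u , _ , refl = <-irrefl refl (proj₁ (proj₂ (∈-closurePairs⁻ cut v a b p1)))

module PathGraph where

  open import Data.Nat
  open import Data.Nat.Properties
  open import Data.Bool using (Bool; false; not)
  open import Data.Fin using (Fin; zero; suc; toℕ; fromℕ<)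
  open import Data.Fin.Properties using (toℕ-injective; toℕ<n; fromℕ<-toℕ; toℕ-fromℕ<)
  open import Data.Product using (Σ; _×_; _,_; proj₁; proj₂)
  open import Data.Empty using (⊥-elim)
  open import Data.List using (List; _∷_; map; length; lookup)
  open import Data.List.Properties using (length-map)
  open import Data.List.Membership.Propositional using (_∈_)
  open import Data.List.Membership.Propositional.Properties using (∈-map⁺; ∈-map⁻)
  open import Data.List.Relation.Unary.Unique.Propositional using (Unique)
  import Data.List.Relation.Unary.Unique.Propositional.Properties as UP
  open import Relation.Binary.PropositionalEquality
  open import Relation.Nullary using (yes; no)
  open import Relation.Binary.Definitions using (tri<; tri≈; tri>)
  open import Function.Bundles using (Equivalence)
  open Segments
  open Counting

  lookup-map-index : ∀ {A B : Set} (f : A → B) (xs : List A) (i : Fin (length (map f xs))) →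
    Σ (Fin (length xs)) λ j → toℕ j ≡ toℕ i × lookup (map f xs) i ≡ f (lookup xs j)
  lookup-map-index f (x ∷ xs) zero = zero , refl , refl
  lookup-map-index f (x ∷ xs) (suc i) with lookup-map-index f xs i
  ... | j , a , b = suc j , cong suc a , b

  pathEdges-length : ∀ n → length (pathEdges n) ≡ pred n
  pathEdges-length zero = refl
  pathEdges-length (suc zero) = refl
  pathEdges-length (suc (suc k)) = cong suc (trans (length-map _ (pathEdges (suc k))) (pathEdges-length (suc k)))

  EdgesJoinNeighbours : ℕ → Set
  EdgesJoinNeighbours n = ∀ (i : Fin (length (pathEdges n))) →
    (toℕ (proj₁ (lookup (pathEdges n) i)) ≡ toℕ i) × (toℕ (proj₂ (lookup (pathEdges n) i)) ≡ suc (toℕ i))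

  pathEdges-lookup′ : ∀ k → EdgesJoinNeighbours (suc k)
  pathEdges-lookup′ zero ()
  pathEdges-lookup′ (suc k) zero = refl , refl
  pathEdges-lookup′ (suc k) (suc i) with lookup-map-index (λ e → suc (proj₁ e) , suc (proj₂ e)) (pathEdges (suc k)) i
  ... | j , j≡i , lookup≡ rewrite lookup≡ =
    cong suc (trans (proj₁ (pathEdges-lookup′ k j)) j≡i) , cong suc (trans (proj₂ (pathEdges-lookup′ k j)) (cong suc j≡i))

  pathEdges-lookup : ∀ n → EdgesJoinNeighbours n
  pathEdges-lookup zero ()
  pathEdges-lookup (suc k) = pathEdges-lookup′ k

  module Instance (n : ℕ) (c : Fin n → ℕ) where
    G = pathGraph n c
    len = length (pathEdges n)
    col : ℕ → ℕ
    col x = pathInput n c (suc x)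
    open Optimality col

    col-toℕ : ∀ (u : Fin n) → col (toℕ u) ≡ c u
    col-toℕ u with toℕ u <? n
    ... | yes p = cong c (fromℕ<-toℕ u p)
    ... | no q = ⊥-elim (q (toℕ<n u))

    cuts : RemovalSet G → ℕ → Bool
    cuts E e with e <? len
    ... | yes p = E (fromℕ< p)
    ... | no _ = false

    cuts-at : ∀ E i → cuts E (toℕ i) ≡ E i
    cuts-at E i with toℕ i <? len
    ... | yes p = cong E (fromℕ<-toℕ i p)
    ... | no q = ⊥-elim (q (toℕ<n i))

    Conn⇒same-segStart : ∀ E {u v} → Conn G E u v → segStart (cuts E) (toℕ u) ≡ segStart (cuts E) (toℕ v)
    Conn⇒same-segStart E (conn-refl u) = refl
    Conn⇒same-segStart E (conn-fwd i e) rewrite proj₁ (pathEdges-lookup n i) | proj₂ (pathEdges-lookup n i) | cuts-at E i | e = refl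
    Conn⇒same-segStart E (conn-bwd i e) rewrite proj₁ (pathEdges-lookup n i) | proj₂ (pathEdges-lookup n i) | cuts-at E i | e = refl
    Conn⇒same-segStart E (conn-trans p q) = trans (Conn⇒same-segStart E p) (Conn⇒same-segStart E q)

    uncut⇒Conn : ∀ E m (u v : Fin n) → toℕ u + m ≡ toℕ v → (∀ e → toℕ u ≤ e → e < toℕ v → cuts E e ≡ false) → Conn G E u v
    uncut⇒Conn E zero u v eq h = subst (Conn G E u) (toℕ-injective (trans (sym (+-identityʳ _)) eq)) (conn-refl u)
    uncut⇒Conn E (suc m) u v eq h = conn-trans (uncut⇒Conn E m u w (sym (toℕ-fromℕ< a<n)) h') step
      where
        a = toℕ u + m
        sa : suc a ≡ toℕ v
        sa = trans (sym (+-suc (toℕ u) m)) eq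
        a<n : a < n
        a<n = ≤-trans (≤-reflexive sa) (<⇒≤ (toℕ<n v))
        w : Fin n
        w = fromℕ< a<n
        h' : ∀ e → toℕ u ≤ e → e < toℕ w → cuts E e ≡ false
        h' e x y = h e x (≤-trans y (≤-trans (≤-reflexive (toℕ-fromℕ< a<n)) (≤-trans (n≤1+n a) (≤-reflexive sa))))
        a<len : a < len
        a<len = ≤-trans (≤-pred' (≤-trans (s≤s (≤-reflexive sa)) (toℕ<n v))) (≤-reflexive (sym (pathEdges-length n)))
          where ≤-pred' : suc (suc a) ≤ n → suc a ≤ pred n
                ≤-pred' (s≤s p) = p
        i : Fin len
        i = fromℕ< a<len
        ti : toℕ i ≡ a
        ti = toℕ-fromℕ< a<len
        ei : E i ≡ false
        ei = trans (sym (cuts-at E i)) (trans (cong (cuts E) ti) (h a (m≤m+n (toℕ u) m) (≤-reflexive sa)))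
        e1 : proj₁ (lookup (pathEdges n) i) ≡ w
        e1 = toℕ-injective (trans (proj₁ (pathEdges-lookup n i)) (trans ti (sym (toℕ-fromℕ< a<n))))
        e2 : proj₂ (lookup (pathEdges n) i) ≡ v
        e2 = toℕ-injective (trans (proj₂ (pathEdges-lookup n i)) (trans (cong suc ti) sa))
        step : Conn G E w v
        step = subst₂ (Conn G E) e1 e2 (conn-fwd i ei)

    same-segStart⇒Conn : ∀ E (u v : Fin n) → toℕ u ≤ toℕ v → segStart (cuts E) (toℕ u) ≡ segStart (cuts E) (toℕ v) → Conn G E u v
    same-segStart⇒Conn E u v le se = uncut⇒Conn E (toℕ v ∸ toℕ u) u v (m+[n∸m]≡n le) (same-segStart⇒uncut (cuts E) (toℕ u) (toℕ v) le se)

    AllColorful⇒Feasible : ∀ E → AllColorful G E → Feasible (cuts E) n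
    AllColorful⇒Feasible E ac a b ab bn se ce = <-irrefl (trans (sym (toℕ-fromℕ< an)) (trans (cong toℕ uv) (toℕ-fromℕ< bn))) ab
      where
        an = <-trans ab bn
        u = fromℕ< an
        v = fromℕ< bn
        tu = toℕ-fromℕ< an
        tv = toℕ-fromℕ< bn
        cn : Conn G E u v
        cn = same-segStart⇒Conn E u v (subst₂ _≤_ (sym tu) (sym tv) (<⇒≤ ab)) (subst₂ (λ x y → segStart (cuts E) x ≡ segStart (cuts E) y) (sym tu) (sym tv) se)
        uv : u ≡ v
        uv = ac u v cn (trans (sym (col-toℕ u)) (trans (cong col tu) (trans ce (trans (cong col (sym tv)) (col-toℕ v)))))

    Feasible⇒AllColorful : ∀ E → Feasible (cuts E) n → AllColorful G E
    Feasible⇒AllColorful E vp u v cn ce with <-cmp (toℕ u) (toℕ v)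
    ... | tri≈ _ e _ = toℕ-injective e
    ... | tri< lt _ _ = ⊥-elim (vp _ _ lt (toℕ<n v) (Conn⇒same-segStart E cn) (trans (col-toℕ u) (trans ce (sym (col-toℕ v)))))
    ... | tri> _ _ gt = ⊥-elim (vp _ _ gt (toℕ<n u) (sym (Conn⇒same-segStart E cn)) (trans (col-toℕ v) (trans (sym ce) (sym (col-toℕ u)))))

    toℕ² : Fin n × Fin n → ℕ × ℕ
    toℕ² (u , v) = toℕ u , toℕ v

    toℕ²-injective : ∀ {x y} → toℕ² x ≡ toℕ² y → x ≡ y
    toℕ²-injective {u , v} {u' , v'} e = cong₂ _,_ (toℕ-injective (cong proj₁ e)) (toℕ-injective (cong proj₂ e))

    TCSize⇒closure : ∀ E k → TCSize G E k → k ≡ closure (cuts E) n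
    TCSize⇒closure E k (L , uq , mem , refl) = ≤-antisym length≤ ≤length
      where
        open Equivalence
        cut = cuts E
        toℕ²-L⊆closurePairs : ∀ {x} → x ∈ map toℕ² L → x ∈ closurePairs cut n
        toℕ²-L⊆closurePairs {x} p with ∈-map⁻ toℕ² p
        ... | (u , v) , q , refl with to (mem u v) q
        ...   | lt , cn = ∈-closurePairs⁺ cut n (toℕ u) (toℕ v) lt (toℕ<n v) (Conn⇒same-segStart E cn)
        closurePairs⊆toℕ²-L : ∀ {x} → x ∈ closurePairs cut n → x ∈ map toℕ² L
        closurePairs⊆toℕ²-L {a , b} p with ∈-closurePairs⁻ cut n a b p
        ... | ab , bn , se = subst (_∈ map toℕ² L) (cong₂ _,_ tu tv) (∈-map⁺ toℕ² (from (mem u v) (ult , same-segStart⇒Conn E u v (<⇒≤ ult) se')))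
          where
            an = <-trans ab bn
            u = fromℕ< an
            v = fromℕ< bn
            tu = toℕ-fromℕ< an
            tv = toℕ-fromℕ< bn
            ult : toℕ u < toℕ v
            ult = subst₂ _<_ (sym tu) (sym tv) ab
            se' : segStart cut (toℕ u) ≡ segStart cut (toℕ v)
            se' = subst₂ (λ x y → segStart cut x ≡ segStart cut y) (sym tu) (sym tv) se
        length≤ : length L ≤ closure cut n
        length≤ = ≤-trans (≤-reflexive (sym (length-map toℕ² L)))
               (≤-trans (Unique-⊆⇒length≤ (map toℕ² L) (closurePairs cut n) (UP.map⁺ toℕ²-injective uq) toℕ²-L⊆closurePairs) (≤-reflexive (closurePairs-length cut n)))
        ≤length : closure cut n ≤ length L
        ≤length = ≤-trans (≤-reflexive (sym (closurePairs-length cut n)))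
               (≤-trans (Unique-⊆⇒length≤ (closurePairs cut n) (map toℕ² L) (closurePairs-unique cut n) closurePairs⊆toℕ²-L) (≤-reflexive (length-map toℕ² L)))

    open Algorithm col using (tables; reconstruct)

    marks : ℕ → ℕ
    marks = reconstruct (proj₂ (tables n)) n n (λ _ → 0)

    OutputsMarks : Memory → Set
    OutputsMarks M = ∀ e → suc e < n → M (suc e) ≡ marks (suc e)

    optimal : (M : Memory) → OutputsMarks M → OptimalMEC G (decodeRemovalFor n c M)
    optimal M marked = Feasible⇒AllColorful E* feasible , maximal
      where
        E* = decodeRemovalFor n c M
        reconstructed = Reconstruction.reconstruct-correct n n n (λ _ → 0) ≤-refl ≤-refl (λ _ _ _ → refl)
        agree : ∀ e → suc e < n → cuts E* e ≡ cutsOf marks e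
        agree e e<n with e <? len
        ... | yes p = cong (λ z → not (z ≡ᵇ 0)) (trans (cong (λ z → M (suc z)) (toℕ-fromℕ< p)) (marked e e<n))
        ... | no q = ⊥-elim (q (≤-trans (<⇒≤pred e<n) (≤-reflexive (sym (pathEdges-length n)))))
        feasible : Feasible (cuts E*) n
        feasible a b a<b b<n same = proj₂ (proj₂ reconstructed) a b a<b b<n
          (trans (sym (segStart-agree _ _ n agree a (<-trans a<b b<n))) (trans same (segStart-agree _ _ n agree b b<n)))
        maximal : ∀ E'' → AllColorful G E'' → ∀ k k'' → TCSize G E* k → TCSize G E'' k'' → k'' ≤ k
        maximal E'' colorful k k'' size* size'' = begin
          k''                       ≡⟨ TCSize⇒closure E'' k'' size'' ⟩
          closure (cuts E'') n      ≤⟨ closure≤best (cuts E'') n (AllColorful⇒Feasible E'' colorful) ⟩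
          best n                    ≡⟨ sym (proj₁ (proj₂ reconstructed)) ⟩
          closure (cutsOf marks) n  ≡⟨ sym (closure-agree _ _ n agree n ≤-refl) ⟩
          closure (cuts E*) n       ≡⟨ sym (TCSize⇒closure E* k size*) ⟩
          k                         ∎
          where open ≤-Reasoning

module Hoare where

  open import Data.Nat
  open import Data.Nat.Properties
  open import Data.Bool using (if_then_else_)
  open import Data.Maybe using (Maybe; just)
  open import Data.List using ([]; _∷_; _++_; replicate; drop)
  open import Relation.Binary.PropositionalEquality
  open Memories

  stepRun : Program → ℕ → ℕ → Memory → Instr → Maybe Memory
  stepRun P fuel pc M (set d k) = run P fuel (suc pc) (write M d k)
  stepRun P fuel pc M (add a b d) = run P fuel (suc pc) (write M d (M a + M b))
  stepRun P fuel pc M (sub a b d) = run P fuel (suc pc) (write M d (M a ∸ M b))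
  stepRun P fuel pc M (load a d) = run P fuel (suc pc) (write M d (M (M a)))
  stepRun P fuel pc M (store a s) = run P fuel (suc pc) (write M (M a) (M s))
  stepRun P fuel pc M (jz a l) = if M a ≡ᵇ 0 then run P fuel l M else run P fuel (suc pc) M
  stepRun P fuel pc M (jmp l) = run P fuel l M
  stepRun P fuel pc M halt = just M

  run-suc : ∀ P fuel pc M → run P (suc fuel) pc M ≡ stepRun P fuel pc M (fetch P pc)
  run-suc P fuel pc M with fetch P pc
  ... | set d k = refl
  ... | add a b d = refl
  ... | sub a b d = refl
  ... | load a d = refl
  ... | store a s = refl
  ... | jz a l = refl
  ... | jmp l = refl
  ... | halt = refl

  -- Started at pc with memory M, P arrives at pc' within T steps, in a memory satisfying Q.
  record Reach (P : Program) (pc : ℕ) (M : Memory) (pc' : ℕ) (Q : Memory → Set) (T : ℕ) : Set where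
    constructor reach
    field
      steps : ℕ
      steps≤ : steps ≤ T
      M' : Memory
      post : Q M'
      run-≡ : ∀ fuel → run P (steps + fuel) pc M ≡ run P fuel pc' M'

  module _ {P : Program} where

    done : ∀ {pc M Q T} → Q M → Reach P pc M pc Q T
    done q = reach 0 z≤n _ q (λ _ → refl)

    weaken-time : ∀ {pc M pc' Q T T'} → T ≤ T' → Reach P pc M pc' Q T → Reach P pc M pc' Q T'
    weaken-time T≤T' (reach t t≤T M' q eq) = reach t (≤-trans t≤T T≤T') M' q eq

    weaken-post : ∀ {pc M pc' Q Q' T} → (∀ M → Q M → Q' M) → Reach P pc M pc' Q T → Reach P pc M pc' Q' T
    weaken-post Q⇒Q' (reach t t≤T M' q eq) = reach t t≤T M' (Q⇒Q' _ q) eq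

    at-pc : ∀ {pc pc₁ M pc' Q T} → pc ≡ pc₁ → Reach P pc₁ M pc' Q T → Reach P pc M pc' Q T
    at-pc refl r = r

    seq : ∀ {pc M pc₁ Q₁ T₁ pc₂ Q₂ T₂} → Reach P pc M pc₁ Q₁ T₁ →
          (∀ M₁ → Q₁ M₁ → Reach P pc₁ M₁ pc₂ Q₂ T₂) → Reach P pc M pc₂ Q₂ (T₁ + T₂)
    seq {pc} {M} (reach t₁ t₁≤ M₁ q₁ eq₁) k with k M₁ q₁
    ... | reach t₂ t₂≤ M₂ q₂ eq₂ = reach (t₁ + t₂) (+-mono-≤ t₁≤ t₂≤) M₂ q₂
          (λ f → trans (cong (λ z → run P z pc M) (+-assoc t₁ t₂ f)) (trans (eq₁ (t₂ + f)) (eq₂ f)))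

    private
      step : ∀ {pc M pc₁ M₁ pc' Q T} → (∀ f → run P (suc f) pc M ≡ run P f pc₁ M₁) →
             Reach P pc₁ M₁ pc' Q T → Reach P pc M pc' Q (suc T)
      step h (reach t t≤T M' q eq) = reach (suc t) (s≤s t≤T) M' q (λ f → trans (h (t + f)) (eq f))

      step-fetch : ∀ {pc M pc₁ M₁ pc' Q T i} → fetch P pc ≡ i → (∀ f → stepRun P f pc M i ≡ run P f pc₁ M₁) →
                   Reach P pc₁ M₁ pc' Q T → Reach P pc M pc' Q (suc T)
      step-fetch {pc} {M} e h = step (λ f → trans (run-suc P f pc M) (trans (cong (stepRun P f pc M) e) (h f)))

    step-set : ∀ {pc M pc' Q T d k} → fetch P pc ≡ set d k →
               Reach P (suc pc) (write M d k) pc' Q T → Reach P pc M pc' Q (suc T)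
    step-set e = step-fetch e (λ _ → refl)

    step-add : ∀ {pc M pc' Q T a b d} → fetch P pc ≡ add a b d →
               Reach P (suc pc) (write M d (M a + M b)) pc' Q T → Reach P pc M pc' Q (suc T)
    step-add e = step-fetch e (λ _ → refl)

    step-sub : ∀ {pc M pc' Q T a b d} → fetch P pc ≡ sub a b d →
               Reach P (suc pc) (write M d (M a ∸ M b)) pc' Q T → Reach P pc M pc' Q (suc T)
    step-sub e = step-fetch e (λ _ → refl)

    step-load : ∀ {pc M pc' Q T a d} → fetch P pc ≡ load a d →
                Reach P (suc pc) (write M d (M (M a))) pc' Q T → Reach P pc M pc' Q (suc T)
    step-load e = step-fetch e (λ _ → refl)

    step-store : ∀ {pc M pc' Q T a s} → fetch P pc ≡ store a s →
                 Reach P (suc pc) (write M (M a) (M s)) pc' Q T → Reach P pc M pc' Q (suc T)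
    step-store e = step-fetch e (λ _ → refl)

    step-jmp : ∀ {pc M pc' Q T l} → fetch P pc ≡ jmp l → Reach P l M pc' Q T → Reach P pc M pc' Q (suc T)
    step-jmp e = step-fetch e (λ _ → refl)

    step-jz-zero : ∀ {pc M pc' Q T a l} → fetch P pc ≡ jz a l → M a ≡ 0 →
                   Reach P l M pc' Q T → Reach P pc M pc' Q (suc T)
    step-jz-zero {pc} {M} {l = l} e z = step-fetch e (λ f → cong (λ v → if v ≡ᵇ 0 then run P f l M else run P f (suc pc) M) z)

    step-jz-suc : ∀ {pc M pc' Q T a l v} → fetch P pc ≡ jz a l → M a ≡ suc v →
                  Reach P (suc pc) M pc' Q T → Reach P pc M pc' Q (suc T)
    step-jz-suc {pc} {M} {l = l} e z = step-fetch e (λ f → cong (λ v → if v ≡ᵇ 0 then run P f l M else run P f (suc pc) M) z)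

    halts : ∀ {pc M Q T fuel} → fetch P pc ≡ halt → Reach P 0 M pc Q T → T < fuel →
            Σ Memory λ R → (run P fuel 0 M ≡ just R) × Q R
    halts {pc} {M} {T = T} {fuel} e (reach t t≤T M' q eq) T<fuel = M' , trans (cong (λ z → run P z 0 M) fuel≡) halted , q
      where
        k = fuel ∸ suc t
        fuel≡ : fuel ≡ t + suc k
        fuel≡ = begin
          fuel            ≡⟨ sym (m+[n∸m]≡n (≤-trans (s≤s t≤T) T<fuel)) ⟩
          suc t + k       ≡⟨ sym (+-suc t k) ⟩
          t + suc k       ∎
          where open ≡-Reasoning
        halted : run P (t + suc k) 0 M ≡ just M'
        halted = trans (eq (suc k)) (trans (run-suc P k pc M') (cong (stepRun P k pc M') e))

    -- I m: loop invariant with m iterations left; S: cost of one iteration; E: cost of the exit.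
    loop : ∀ {h ex Q} (I : ℕ → Memory → Set) (S E : ℕ) →
           (∀ M → I 0 M → Reach P h M ex Q E) →
           (∀ m M → I (suc m) M → Reach P h M h (I m) S) →
           ∀ m M → I m M → Reach P h M ex Q (m * S + E)
    loop I S E exit body zero M i = exit M i
    loop I S E exit body (suc m) M i =
      weaken-time (≤-reflexive (sym (+-assoc S (m * S) E))) (seq (body m M i) (loop I S E exit body m))

    private
      shift-fetch : ∀ {pc k x} → (∀ i → i < suc k → fetch P (pc + i) ≡ x) →
                    fetch P pc ≡ x × (∀ i → i < k → fetch P (suc pc + i) ≡ x)
      shift-fetch {pc} h = trans (cong (fetch P) (sym (+-identityʳ pc))) (h 0 z<s) ,
                           λ i i<k → trans (cong (fetch P) (sym (+-suc pc i))) (h (suc i) (s≤s i<k))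

    repeat-add : ∀ a b k pc M {pc' Q T} → a ≢ b → (∀ i → i < k → fetch P (pc + i) ≡ add a b a) →
      (∀ M' → M' a ≡ M a + k * M b → (∀ y → y ≢ a → M' y ≡ M y) → Reach P (pc + k) M' pc' Q T) →
      Reach P pc M pc' Q (k + T)
    repeat-add a b zero pc M a≢b h k = at-pc (sym (+-identityʳ pc)) (k M (sym (+-identityʳ (M a))) (λ _ _ → refl))
    repeat-add a b (suc n) pc M a≢b h k with shift-fetch h
    ... | here , rest = step-add here (repeat-add a b n (suc pc) _ a≢b rest λ M' eqa eqo →
          at-pc (sym (+-suc pc n)) (k M' (trans eqa (trans (cong₂ (λ x y → x + n * y) (write-≡ M a _) (write-≢ M a _ b (≢-sym a≢b))) (+-assoc (M a) (M b) (n * M b))))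
                                        (λ y y≢a → trans (eqo y y≢a) (write-≢ M a _ y y≢a))))

    repeat-sub : ∀ a b k pc M {pc' Q T} → a ≢ b → (∀ i → i < k → fetch P (pc + i) ≡ sub a b a) →
      (∀ M' → M' a ≡ M a ∸ k * M b → (∀ y → y ≢ a → M' y ≡ M y) → Reach P (pc + k) M' pc' Q T) →
      Reach P pc M pc' Q (k + T)
    repeat-sub a b zero pc M a≢b h k = at-pc (sym (+-identityʳ pc)) (k M refl (λ _ _ → refl))
    repeat-sub a b (suc n) pc M a≢b h k with shift-fetch h
    ... | here , rest = step-sub here (repeat-sub a b n (suc pc) _ a≢b rest λ M' eqa eqo →
          at-pc (sym (+-suc pc n)) (k M' (trans eqa (trans (cong₂ (λ x y → x ∸ n * y) (write-≡ M a _) (write-≢ M a _ b (≢-sym a≢b))) (∸-+-assoc (M a) (M b) (n * M b))))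
                                        (λ y y≢a → trans (eqo y y≢a) (write-≢ M a _ y y≢a))))

  twice : (ℕ → Instr) → (ℕ → Instr) → ℕ → Program
  twice f g zero = []
  twice f g (suc k) = f 0 ∷ g 0 ∷ twice (λ i → f (suc i)) (λ i → g (suc i)) k

  fetch-drop : ∀ P k i → fetch P (k + i) ≡ fetch (drop k P) i
  fetch-drop P zero i = refl
  fetch-drop [] (suc k) i = refl
  fetch-drop (_ ∷ P) (suc k) i = fetch-drop P k i

  fetch-replicate : ∀ k x ys i → i < k → fetch (replicate k x ++ ys) i ≡ x
  fetch-replicate (suc k) x ys zero _ = refl
  fetch-replicate (suc k) x ys (suc i) (s≤s i<k) = fetch-replicate k x ys i i<k

  fetch-twice-even : ∀ f g k ys i → i < k → fetch (twice f g k ++ ys) (2 * i) ≡ f i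
  fetch-twice-even f g (suc k) ys zero _ = refl
  fetch-twice-even f g (suc k) ys (suc i) (s≤s i<k) rewrite +-suc i (i + 0) =
    fetch-twice-even (λ i → f (suc i)) (λ i → g (suc i)) k ys i i<k

  fetch-twice-odd : ∀ f g k ys i → i < k → fetch (twice f g k ++ ys) (suc (2 * i)) ≡ g i
  fetch-twice-odd f g (suc k) ys zero _ = refl
  fetch-twice-odd f g (suc k) ys (suc i) (s≤s i<k) rewrite +-suc i (i + 0) =
    fetch-twice-odd (λ i → f (suc i)) (λ i → g (suc i)) k ys i i<k

module MECProgram where

  open import Data.Nat using (_+_; _∸_)
  open import Data.List using ([]; _∷_; _++_; replicate)
  open Hoare using (twice)

  -- Each line is annotated with the address of its first instruction.
  prog : Program
  prog =
    jz 0 320 ∷ jz 1 37 ∷                                                  -- 0    n = 0: nothing to do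
    replicate 33 (add 0 1 0) ++ store 0 1 ∷ jmp 71 ∷                      -- 2    B := n + 33 c(0), M[B] := c(0)
    set 1 1 ∷ replicate 33 (add 0 1 0) ++                                 -- 37   c(0) = 0: B := n + 33
    add 0 1 0 ∷ store 0 2 ∷ set 2 1 ∷                                     -- 71   save M[2], …, M[32] from B + δ on
    twice (λ _ → add 0 2 0) (λ i → store 0 (3 + i)) 30 ++                 -- 74
    set 3 31 ∷ sub 0 3 3 ∷ add 3 2 4 ∷ sub 4 1 4 ∷ load 4 8 ∷             -- 134  C := B + δ − 1
    replicate 33 (sub 4 1 4) ++                                           -- 139  M[4] := B − 33 δ = n
    add 4 2 9 ∷ set 5 33 ∷ store 3 8 ∷                                    -- 172  M[C] := c(0)
    sub 9 5 8 ∷ jz 8 183 ∷ load 5 7 ∷ add 3 5 6 ∷ sub 6 2 6 ∷ add 5 2 5 ∷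
      store 6 7 ∷ jmp 175 ∷                                               -- 175  M[C + i] := c(i) for 32 ≤ i < n
    add 3 4 10 ∷ add 10 9 11 ∷ add 11 9 12 ∷ set 13 0 ∷ store 10 13 ∷
      set 14 1 ∷                                                          -- 183  D, E, F; best 0 := 0; j := 1
    sub 9 14 8 ∷ jz 8 229 ∷ set 15 0 ∷ set 16 0 ∷ sub 14 2 17 ∷
      set 18 0 ∷ set 19 1 ∷                                               -- 189  while j ≤ n: i := j − 1
    add 10 17 20 ∷ load 20 21 ∷ add 21 18 21 ∷ sub 15 21 22 ∷ jz 22 202 ∷
      jmp 204 ∷ add 21 13 15 ∷ add 17 13 16 ∷                             -- 196  keepBest
    jz 17 223 ∷ add 3 17 20 ∷ sub 20 2 20 ∷ load 20 23 ∷ add 17 13 24 ∷   -- 204  k := i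
    sub 14 24 8 ∷ jz 8 219 ∷ add 3 24 20 ∷ load 20 25 ∷ sub 23 25 26 ∷
      sub 25 23 27 ∷ add 26 27 26 ∷ jz 26 223 ∷ add 24 2 24 ∷ jmp 209 ∷   -- 209  occurs (col (i − 1)) i (j − i)
    add 18 19 18 ∷ add 19 2 19 ∷ sub 17 2 17 ∷ jmp 196 ∷                  -- 219  i := i − 1
    add 10 14 20 ∷ add 11 14 21 ∷ add 14 2 14 ∷ store 20 15 ∷
      store 21 16 ∷ jmp 189 ∷                                             -- 223  best j, back j; j := j + 1
    set 24 0 ∷ sub 9 24 8 ∷ jz 8 236 ∷ add 12 24 20 ∷ add 24 2 24 ∷
      store 20 13 ∷ jmp 230 ∷                                             -- 229  clear the marks
    add 4 13 14 ∷ jz 14 244 ∷ add 11 14 20 ∷ load 20 17 ∷ add 12 17 20 ∷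
      add 17 13 14 ∷ store 20 2 ∷ jmp 237 ∷                               -- 236  reconstruct
    sub 4 2 14 ∷ set 29 32 ∷                                              -- 244  r := n − 1
    sub 14 29 8 ∷ jz 8 254 ∷ add 12 14 20 ∷ load 20 21 ∷ add 14 13 22 ∷
      sub 14 2 14 ∷ store 22 21 ∷ jmp 246 ∷                               -- 246  M[r] := mark r for n > r > 32
    set 1 1 ∷ set 30 32 ∷ add 12 30 0 ∷                                   -- 254
    twice (λ t → load 0 (32 ∸ t)) (λ _ → sub 0 1 0) 31 ++                 -- 257  M[r] := mark r for 32 ≥ r ≥ 2
    load 0 1 ∷ halt ∷ []                                                  -- 319

-- The input occupies M[1], …, M[n], registers included. From M[0] = n and δ = M[1] = c(0)
-- (or 1 if c(0) = 0) alone, adding δ 33 times gives a free address B = n + 33 δ; the registers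
-- 2, …, 32 are saved above it, and the colours end up at C, C + 1, … with C = B + δ − 1 ≥ 34.
module Relocation (n' : ℕ) (c : Fin (suc n') → ℕ) where

  open import Data.Nat
  open import Data.Nat.Properties
  open import Data.Product using (Σ; _×_; _,_; proj₁; proj₂)
  open import Data.Sum using (inj₁; inj₂)
  open import Data.Empty using (⊥-elim)
  open import Relation.Binary.PropositionalEquality
  open import Relation.Nullary using (yes; no)
  open Arithmetic
  open MECProgram
  open Memories
  open Hoare

  nn : ℕ
  nn = suc n'

  inp : Memory
  inp = pathInput nn c

  col : ℕ → ℕ
  col x = inp (suc x)

  inp-zero : ∀ y → nn < y → inp y ≡ 0
  inp-zero (suc i) lt with i <? nn
  ... | yes p = ⊥-elim (<-irrefl refl (≤-trans lt p))
  ... | no _ = refl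

  record Shifted (B δ : ℕ) (M : Memory) : Set where
    field
      s0 : M 0 ≡ B
      s1 : M 1 ≡ δ
      sδ : 1 ≤ δ
      sB : B ≡ nn + 33 * δ
      sc : M B ≡ col 0
      sreg : ∀ y → 2 ≤ y → y < B → M y ≡ inp y

  34≤B : ∀ δ → 1 ≤ δ → 34 ≤ nn + 33 * δ
  34≤B δ le = +-mono-≤ (s≤s (z≤n {n'})) (*-monoʳ-≤ 33 le)

  n<B : ∀ δ → 1 ≤ δ → nn < nn + 33 * δ
  n<B δ le = m<m+n nn (≤-trans (s≤s z≤n) (*-monoʳ-≤ 33 le))

  data FirstColour : Set where
    positive : ∀ v → inp 1 ≡ suc v → FirstColour
    default : inp 1 ≡ 0 → FirstColour

  firstColour : FirstColour
  firstColour with inp 1 in e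
  ... | zero = default e
  ... | suc v = positive v e

  fetch-shift : ∀ i → i < 33 → fetch prog (2 + i) ≡ add 0 1 0
  fetch-shift i lt = trans (fetch-drop prog 2 i) (fetch-replicate 33 _ _ i lt)

  fetch-shift-default : ∀ i → i < 33 → fetch prog (38 + i) ≡ add 0 1 0
  fetch-shift-default i lt = trans (fetch-drop prog 38 i) (fetch-replicate 33 _ _ i lt)

  shift-colour : ∀ v → inp 1 ≡ suc v → ∀ M0 → M0 0 ≡ nn + 33 * inp 1 → (∀ y → y ≢ 0 → M0 y ≡ inp y) →
    Shifted (nn + 33 * inp 1) (inp 1) (write M0 (M0 0) (M0 1))
  shift-colour v e M0 a0 ao = record { s0 = p0 ; s1 = p1 ; sδ = dl ; sB = refl ; sc = pc ; sreg = pr }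
    where
      B = nn + 33 * inp 1
      dl : 1 ≤ inp 1
      dl = subst (1 ≤_) (sym e) (s≤s z≤n)
      Bb = 34≤B (inp 1) dl
      p0 : write M0 (M0 0) (M0 1) 0 ≡ B
      p0 = trans (write-> M0 (M0 0) (M0 1) 0 (subst (0 <_) (sym a0) (≤-trans (s≤s z≤n) Bb))) a0
      p1 : write M0 (M0 0) (M0 1) 1 ≡ inp 1
      p1 = trans (write-> M0 (M0 0) (M0 1) 1 (subst (1 <_) (sym a0) (≤-trans (s≤s (s≤s z≤n)) Bb))) (ao 1 (λ ()))
      pc : write M0 (M0 0) (M0 1) B ≡ col 0
      pc = trans (write-at {M0} {M0 0} {M0 1} (sym a0)) (ao 1 (λ ()))
      pr : ∀ y → 2 ≤ y → y < B → write M0 (M0 0) (M0 1) y ≡ inp y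
      pr y a b = trans (write-> M0 (M0 0) (M0 1) y (subst (y <_) (sym a0) b)) (ao y (2≤⇒≢0' a))
        where 2≤⇒≢0' : 2 ≤ y → y ≢ 0
              2≤⇒≢0' (s≤s _) ()

  shift-default : inp 1 ≡ 0 → ∀ M0 → M0 0 ≡ nn + 33 * 1 → (∀ y → y ≢ 0 → M0 y ≡ write inp 1 1 y) → Shifted (nn + 33 * 1) 1 M0
  shift-default e M0 a0 ao = record { s0 = a0 ; s1 = ao 1 (λ ()) ; sδ = s≤s z≤n ; sB = refl ; sc = pc ; sreg = pr }
    where
      B = nn + 33 * 1
      Bb = 34≤B 1 (s≤s z≤n)
      pc : M0 B ≡ col 0
      pc = trans (ao B (λ q → <-irrefl (sym q) (≤-trans (s≤s z≤n) Bb))) (trans (write-< inp 1 1 B (≤-trans (s≤s (s≤s z≤n)) Bb)) (trans (inp-zero B (n<B 1 (s≤s z≤n))) (sym e)))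
      pr : ∀ y → 2 ≤ y → y < B → M0 y ≡ inp y
      pr y (s≤s (s≤s _)) b = trans (ao y (λ ())) (write-< inp 1 1 y (s≤s (s≤s z≤n)))

  shift : ∀ {pc' Q T} → (∀ B δ M → Shifted B δ M → Reach prog 71 M pc' Q T) → Reach prog 1 inp pc' Q (36 + T)
  shift {T = T} k with firstColour
  ... | positive v e = step-jz-suc refl e (repeat-add 0 1 33 2 inp (λ ()) fetch-shift (λ M0 a0 ao → step-store refl (step-jmp refl (k _ _ _ (shift-colour v e M0 a0 ao)))))
  ... | default e = weaken-time (n≤1+n _) (step-jz-zero refl e (step-set refl (repeat-add 0 1 33 38 _ (λ ()) fetch-shift-default (λ M0 a0 ao → k _ _ _ (shift-default e M0 a0 ao)))))
  record Saving (B δ r : ℕ) (M : Memory) : Set where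
    field
      m0 : M 0 ≡ B + δ + (r ∸ 3)
      m1 : M 1 ≡ δ
      m2 : M 2 ≡ 1
      mB : M B ≡ col 0
      mMv : ∀ k → 2 ≤ k → k < r → M (B + δ + (k ∸ 2)) ≡ inp k
      mReg : ∀ y → r ≤ y → y < B → M y ≡ inp y

  small< : ∀ {k B} → k ≤ 33 → 34 ≤ B → k < B
  small< a b = ≤-trans (s≤s a) b

  start-saving : ∀ {B δ M} → Shifted B δ M →
    Saving B δ 3 (write (write (write M 0 (M 0 + M 1)) (M 0 + M 1) (M 2)) 2 1)
  start-saving {B} {δ} {M} s = record { m0 = q0 ; m1 = q1 ; m2 = refl ; mB = qB ; mMv = qMv ; mReg = qReg }
    where
      open Shifted s
      A' = M 0 + M 1
      M1 = write M 0 A'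
      M2 = write M1 A' (M 2)
      M3 = write M2 2 1
      eA : A' ≡ B + δ
      eA = cong₂ _+_ s0 s1
      Bb : 34 ≤ B
      Bb = subst (34 ≤_) (sym sB) (34≤B δ sδ)
      B<A : B < A'
      B<A = subst (B <_) (sym eA) (m<m+n B sδ)
      A34 : 34 ≤ A'
      A34 = ≤-trans Bb (<⇒≤ B<A)
      q0 : M3 0 ≡ B + δ + 0
      q0 = trans (write-> M1 A' (M 2) 0 (small< z≤n A34)) (trans eA (sym (+-identityʳ _)))
      q1 : M3 1 ≡ δ
      q1 = trans (write-> M1 A' (M 2) 1 (small< (s≤s z≤n) A34)) s1
      qB : M3 B ≡ col 0
      qB = trans (write-< M2 2 1 B (small< (s≤s (s≤s z≤n)) Bb)) (trans (write-> M1 A' (M 2) B B<A) (trans (write-< M 0 A' B (small< z≤n Bb)) sc))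
      qMv : ∀ k → 2 ≤ k → k < 3 → M3 (B + δ + (k ∸ 2)) ≡ inp k
      qMv .2 (s≤s (s≤s z≤n)) (s≤s (s≤s (s≤s z≤n))) =
        trans (write-< M2 2 1 (B + δ + 0) (small< (s≤s (s≤s z≤n)) (≤-trans A34 (≤-reflexive (trans eA (sym (+-identityʳ _)))))))
          (trans (write-at {M1} {A'} {M 2} (trans (+-identityʳ _) (sym eA)))
            (sreg 2 (s≤s (s≤s z≤n)) (small< (s≤s (s≤s z≤n)) Bb)))
      qReg : ∀ y → 3 ≤ y → y < B → M3 y ≡ inp y
      qReg y a b = trans (write-< M2 2 1 y a) (trans (write-> M1 A' (M 2) y (<-trans b B<A)) (trans (write-< M 0 A' y (≤-trans (s≤s z≤n) a)) (sreg y (≤-trans (n≤1+n 2) a) b)))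

  ∸3-suc : ∀ r → 3 ≤ r → r ∸ 3 + 1 ≡ suc r ∸ 3
  ∸3-suc zero ()
  ∸3-suc (suc zero) (s≤s ())
  ∸3-suc (suc (suc zero)) (s≤s (s≤s ()))
  ∸3-suc (suc (suc (suc r))) _ = +-comm r 1

  save-step : ∀ {B δ r M} → 1 ≤ δ → B ≡ nn + 33 * δ → 3 ≤ r → r ≤ 32 → Saving B δ r M →
    Saving B δ (suc r) (write (write M 0 (M 0 + M 2)) (M 0 + M 2) (write M 0 (M 0 + M 2) r))
  save-step {B} {δ} {r} {M} dl eB r3 r32 mi = record { m0 = q0 ; m1 = q1 ; m2 = q2 ; mB = qB ; mMv = qMv ; mReg = qReg }
    where
      open Saving mi
      A = B + δ
      V = M 0 + M 2
      Bb : 34 ≤ B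
      Bb = subst (34 ≤_) (sym eB) (34≤B δ dl)
      eV : V ≡ A + (suc r ∸ 3)
      eV = trans (cong₂ _+_ m0 m2) (trans (+-assoc A (r ∸ 3) 1) (cong (A +_) (∸3-suc r r3)))
      B<A : B < A
      B<A = m<m+n B dl
      A≤V : A ≤ V
      A≤V = subst (A ≤_) (sym eV) (m≤m+n A _)
      B<V : B < V
      B<V = ≤-trans B<A A≤V
      r<B : r < B
      r<B = ≤-trans (s≤s r32) (≤-trans (n≤1+n 33) Bb)
      M1 = write M 0 V
      vr = write M 0 V r
      M2 = write M1 V vr
      V34 : 34 ≤ V
      V34 = ≤-trans Bb (<⇒≤ B<V)
      q0 : M2 0 ≡ B + δ + (suc r ∸ 3)
      q0 = trans (write-> M1 V vr 0 (small< z≤n V34)) eV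
      q1 : M2 1 ≡ δ
      q1 = trans (write-> M1 V vr 1 (small< (s≤s z≤n) V34)) m1
      q2 : M2 2 ≡ 1
      q2 = trans (write-> M1 V vr 2 (small< (s≤s (s≤s z≤n)) V34)) m2
      qB : M2 B ≡ col 0
      qB = trans (write-> M1 V vr B B<V) (trans (write-< M 0 V B (small< z≤n Bb)) mB)
      qMv : ∀ k → 2 ≤ k → k < suc r → M2 (B + δ + (k ∸ 2)) ≡ inp k
      qMv k a b with m≤n⇒m<n∨m≡n (≤-pred b)
      ... | inj₂ refl = trans (write-at {M1} {V} {vr} (sym eV)) (trans (write-< M 0 V k (≤-trans (s≤s z≤n) r3)) (mReg k ≤-refl r<B))
      ... | inj₁ lt = trans (write-> M1 V vr (A + (k ∸ 2)) (≤-trans (+-monoʳ-< A (∸-monoˡ-< lt a)) (≤-reflexive (sym eV))))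
                       (trans (write-< M 0 V (A + (k ∸ 2)) (≤-trans (small< z≤n (≤-trans Bb (<⇒≤ B<A))) (m≤m+n A (k ∸ 2)))) (mMv k a lt))
      qReg : ∀ y → suc r ≤ y → y < B → M2 y ≡ inp y
      qReg y a b = trans (write-> M1 V vr y (<-trans b B<V)) (trans (write-< M 0 V y (≤-trans (s≤s z≤n) a)) (mReg y (≤-trans (n≤1+n r) a) b))

  fetch-save-add : ∀ i → i < 30 → fetch prog (74 + 2 * i) ≡ add 0 2 0
  fetch-save-add i lt = trans (fetch-drop prog 74 (2 * i)) (fetch-twice-even (λ _ → add 0 2 0) (λ i → store 0 (3 + i)) 30 _ i lt)

  fetch-save-store : ∀ i → i < 30 → fetch prog (75 + 2 * i) ≡ store 0 (3 + i)
  fetch-save-store i lt = trans (fetch-drop prog 74 (suc (2 * i))) (fetch-twice-odd (λ _ → add 0 2 0) (λ i → store 0 (3 + i)) 30 _ i lt)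

  save-pc : ∀ r → 3 ≤ r → suc (suc (74 + 2 * (r ∸ 3))) ≡ 74 + 2 * (suc r ∸ 3)
  save-pc zero ()
  save-pc (suc zero) (s≤s ())
  save-pc (suc (suc zero)) (s≤s (s≤s ()))
  save-pc (suc (suc (suc r))) _ = cong (λ z → 74 + z) (sym (*-suc 2 r))

  save-registers : ∀ {B δ} → 1 ≤ δ → B ≡ nn + 33 * δ → ∀ m r M → r + m ≡ 33 → 3 ≤ r → Saving B δ r M →
          Reach prog (74 + 2 * (r ∸ 3)) M 134 (Saving B δ 33) (m * 2)
  save-registers dl eB zero r M e r3 mi rewrite +-identityʳ r | e = done mi
  save-registers {B} {δ} dl eB (suc m) r M e r3 mi =
    step-add (fetch-save-add (r ∸ 3) i<) (step-store (trans (fetch-save-store (r ∸ 3) i<) (cong (store 0) (m+[n∸m]≡n r3)))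
      (at-pc (save-pc r r3) (save-registers dl eB m (suc r) _ (trans (sym (+-suc r m)) e) (≤-trans r3 (n≤1+n r))
        (save-step dl eB r3 r32 mi))))
    where
      r32 : r ≤ 32
      r32 = ≤-pred (≤-trans (≤-trans (s≤s (m≤m+n r m)) (≤-reflexive (sym (+-suc r m)))) (≤-reflexive e))
      i30 : ∀ r → 3 ≤ r → r ≤ 32 → r ∸ 3 < 30
      i30 (suc (suc (suc r))) _ (s≤s (s≤s (s≤s le))) = s≤s le
      i30 zero () _
      i30 (suc zero) (s≤s ()) _
      i30 (suc (suc zero)) (s≤s (s≤s ())) _
      i< : r ∸ 3 < 30
      i< = i30 r r3 r32

  record Copying (C i : ℕ) (M : Memory) : Set where
    field
      c2 : M 2 ≡ 1
      c3 : M 3 ≡ C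
      c4 : M 4 ≡ nn
      c9 : M 9 ≡ suc nn
      c5 : M 5 ≡ suc i
      cCol : ∀ x → x < i → M (C + x) ≡ col x
      cSrc : ∀ y → suc i ≤ y → y ≤ nn → M y ≡ inp y
      cC : 34 ≤ C
      cn : nn < C
      ci : 32 ≤ i

  +30∸31+1 : ∀ A → 1 ≤ A → ((A + 30) ∸ 31) + 1 ≡ A
  +30∸31+1 (suc A) _ = trans (cong (_+ 1) (m+n∸n≡m A 30)) (+-comm A 1)

  +-shift-1 : ∀ C x → 1 ≤ x → C + x ≡ (C + 1) + (suc x ∸ 2)
  +-shift-1 C (suc x) _ = trans (+-suc C x) (cong (_+ x) (+-comm 1 C))

  locate-colours : ∀ {B δ M pc' Q T} → 1 ≤ δ → B ≡ nn + 33 * δ → Saving B δ 33 M →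
    (∀ M5 → M5 3 ≡ (B + δ + 30) ∸ 31 → M5 4 ≡ B → M5 8 ≡ col 0 → M5 1 ≡ δ → M5 2 ≡ 1 → (∀ x → 9 ≤ x → M5 x ≡ M x) →
       Reach prog 139 M5 pc' Q T) → Reach prog 134 M pc' Q (5 + T)
  locate-colours {B} {δ} {M} dl eB mi k = step-set refl (step-sub refl (step-add refl (step-sub refl (step-load refl (k _ f3 f4 f8 f1 f2 fx)))))
    where
      open Saving mi
      Bb : 34 ≤ B
      Bb = subst (34 ≤_) (sym eB) (34≤B δ dl)
      C = (B + δ + 30) ∸ 31
      W1 = write M 3 31
      W2 = write W1 3 (M 0 ∸ 31)
      W3 = write W2 4 ((M 0 ∸ 31) + M 2)
      Bv = ((M 0 ∸ 31) + M 2) ∸ M 1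
      W4 = write W3 4 Bv
      eC : M 0 ∸ 31 ≡ C
      eC = cong (_∸ 31) m0
      eBv : Bv ≡ B
      eBv = trans (cong₂ (λ x y → (x + y) ∸ M 1) eC m2) (trans (cong (((B + δ + 30) ∸ 31 + 1) ∸_) m1)
              (trans (cong (_∸ δ) (+30∸31+1 (B + δ) (≤-trans dl (m≤n+m δ B)))) (m+n∸n≡m B δ)))
      f3 : M 0 ∸ 31 ≡ C
      f3 = eC
      f4 : Bv ≡ B
      f4 = eBv
      Bv34 : 34 ≤ Bv
      Bv34 = subst (34 ≤_) (sym eBv) Bb
      f8 : W4 Bv ≡ col 0
      f8 = trans (write-< W3 4 Bv Bv (small< (s≤s (s≤s (s≤s (s≤s z≤n)))) Bv34))
            (trans (write-< W2 4 _ Bv (small< (s≤s (s≤s (s≤s (s≤s z≤n)))) Bv34))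
            (trans (write-< W1 3 _ Bv (small< (s≤s (s≤s (s≤s z≤n))) Bv34))
            (trans (write-< M 3 31 Bv (small< (s≤s (s≤s (s≤s z≤n))) Bv34)) (trans (cong M eBv) mB))))
      f1 : M 1 ≡ δ
      f1 = m1
      f2 : M 2 ≡ 1
      f2 = m2
      fx : ∀ x → 9 ≤ x → write W4 8 (W4 Bv) x ≡ M x
      fx x a = trans (write-< W4 8 _ x a) (trans (write-< W3 4 _ x (≤-trans (s≤s (s≤s (s≤s (s≤s (s≤s z≤n))))) a))
                 (trans (write-< W2 4 _ x (≤-trans (s≤s (s≤s (s≤s (s≤s (s≤s z≤n))))) a))
                 (trans (write-< W1 3 _ x (≤-trans (s≤s (s≤s (s≤s (s≤s z≤n)))) a)) (write-< M 3 31 x (≤-trans (s≤s (s≤s (s≤s (s≤s z≤n)))) a)))))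

  fetch-recover-n : ∀ i → i < 33 → fetch prog (139 + i) ≡ sub 4 1 4
  fetch-recover-n i lt = trans (fetch-drop prog 139 i) (fetch-replicate 33 _ _ i lt)

  colours-located : ∀ {B δ M} → 1 ≤ δ → B ≡ nn + 33 * δ → Saving B δ 33 M → ∀ M6 →
    M6 3 ≡ (B + δ + 30) ∸ 31 → M6 4 ≡ nn → M6 8 ≡ col 0 → M6 2 ≡ 1 → (∀ x → 9 ≤ x → M6 x ≡ M x) →
    Reach prog 172 M6 175 (λ M' → Σ ℕ λ C → Copying C 32 M') 3
  colours-located {B} {δ} {M} dl eB mi M6 f3 f4 f8 f2 fx = step-add refl (step-set refl (step-store refl (done (C , inv))))
    where
      open Saving mi
      Bb : 34 ≤ B
      Bb = subst (34 ≤_) (sym eB) (34≤B δ dl)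
      C = (B + δ + 30) ∸ 31
      eC1 : C + 1 ≡ B + δ
      eC1 = +30∸31+1 (B + δ) (≤-trans dl (m≤n+m δ B))
      B≤C : B ≤ C
      B≤C = +-cancelʳ-≤ 1 B C (≤-trans (+-monoʳ-≤ B dl) (≤-reflexive (sym eC1)))
      C34 : 34 ≤ C
      C34 = ≤-trans Bb B≤C
      nB : nn < B
      nB = subst (nn <_) (sym eB) (n<B δ dl)
      X1 = write M6 9 (M6 4 + M6 2)
      X2 = write X1 5 33
      X3 = write X2 (M6 3) (M6 8)
      C6 : 34 ≤ M6 3
      C6 = subst (34 ≤_) (sym f3) C34
      inv : Copying C 32 X3
      inv = record
        { c2 = trans (write-> X2 (M6 3) (M6 8) 2 (small< (s≤s (s≤s z≤n)) C6)) f2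
        ; c3 = trans (write-> X2 (M6 3) (M6 8) 3 (small< (s≤s (s≤s (s≤s z≤n))) C6)) f3
        ; c4 = trans (write-> X2 (M6 3) (M6 8) 4 (small< (s≤s (s≤s (s≤s (s≤s z≤n)))) C6)) f4
        ; c9 = trans (write-> X2 (M6 3) (M6 8) 9 (small< (s≤s (s≤s (s≤s (s≤s (s≤s (s≤s (s≤s (s≤s (s≤s z≤n))))))))) C6)) (trans (cong₂ _+_ f4 f2) (+-comm nn 1))
        ; c5 = write-> X2 (M6 3) (M6 8) 5 (small< (s≤s (s≤s (s≤s (s≤s (s≤s z≤n))))) C6)
        ; cCol = cc
        ; cSrc = cs
        ; cC = C34
        ; cn = <-≤-trans nB B≤C
        ; ci = ≤-refl
        }
        where
          cc : ∀ x → x < 32 → X3 (C + x) ≡ col x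
          cc zero _ = trans (write-at {X2} {M6 3} {M6 8} (trans (+-identityʳ C) (sym f3))) f8
          cc (suc x) lt = trans (write-< X2 (M6 3) (M6 8) (C + suc x) (subst (_< C + suc x) (sym f3) (m<m+n C (s≤s z≤n))))
            (trans (write-< X1 5 33 (C + suc x) (small< (s≤s (s≤s (s≤s (s≤s (s≤s z≤n))))) (≤-trans C34 (m≤m+n C _))))
            (trans (write-< M6 9 _ (C + suc x) (small< (s≤s (s≤s (s≤s (s≤s (s≤s (s≤s (s≤s (s≤s (s≤s z≤n))))))))) (≤-trans C34 (m≤m+n C _))))
            (trans (fx (C + suc x) (≤-trans (s≤s (s≤s (s≤s (s≤s (s≤s (s≤s (s≤s (s≤s (s≤s z≤n))))))))) (≤-trans C34 (m≤m+n C _))))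
            (trans (cong M (trans (+-shift-1 C (suc x) (s≤s z≤n)) (cong (_+ (suc (suc x) ∸ 2)) eC1)))
              (mMv (suc (suc x)) (s≤s (s≤s z≤n)) (s≤s lt))))))
          cs : ∀ y → 33 ≤ y → y ≤ nn → X3 y ≡ inp y
          cs y a b = trans (write-> X2 (M6 3) (M6 8) y (subst (y <_) (sym f3) (≤-trans (s≤s b) (<-≤-trans nB B≤C))))
            (trans (write-< X1 5 33 y (≤-trans (s≤s (s≤s (s≤s (s≤s (s≤s (s≤s z≤n)))))) a))
            (trans (write-< M6 9 _ y (≤-trans (s≤s (s≤s (s≤s (s≤s (s≤s (s≤s (s≤s (s≤s (s≤s (s≤s z≤n)))))))))) a))
            (trans (fx y (≤-trans (s≤s (s≤s (s≤s (s≤s (s≤s (s≤s (s≤s (s≤s (s≤s z≤n))))))))) a))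
              (mReg y a (≤-trans (s≤s b) nB)))))

  save-and-locate : ∀ B δ M → Shifted B δ M → Reach prog 71 M 175 (λ M' → Σ ℕ λ C → Copying C 32 M') 104
  save-and-locate B δ M s =
    step-add refl (step-store refl (step-set refl (seq (save-registers sδ sB 30 3 _ refl (s≤s (s≤s (s≤s z≤n))) (start-saving s)) k)))
    where
      open Shifted s
      k : ∀ M' → Saving B δ 33 M' → Reach prog 134 M' 175 (λ M' → Σ ℕ λ C → Copying C 32 M') 41
      k M' mi = locate-colours sδ sB mi (λ M5 f3 f4 f8 f1 f2 fx →
        repeat-sub 4 1 33 139 M5 (λ ()) fetch-recover-n (λ M6 a4 ao →
          colours-located sδ sB mi M6 (trans (ao 3 (λ ())) f3)
            (trans a4 (trans (cong₂ (λ x y → x ∸ 33 * y) f4 f1) (trans (cong (_∸ 33 * δ) sB) (m+n∸n≡m nn (33 * δ)))))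
            (trans (ao 8 (λ ())) f8) (trans (ao 2 (λ ())) f2)
            (λ x a → trans (ao x (λ q → <-irrefl (sym q) (≤-trans (s≤s (s≤s (s≤s (s≤s (s≤s z≤n))))) a))) (fx x a))))

  relocate : Reach prog 1 inp 175 (λ M' → Σ ℕ λ C → Copying C 32 M') 140
  relocate = shift save-and-locate

  record Colours (C : ℕ) (M : Memory) : Set where
    field
      b2 : M 2 ≡ 1
      b3 : M 3 ≡ C
      b4 : M 4 ≡ nn
      b9 : M 9 ≡ suc nn
      bCol : ∀ x → x < nn → M (C + x) ≡ col x
      bC : 34 ≤ C
      bn : nn < C

  copy-step : ∀ C i m M → nn ∸ i ≡ suc m → Copying C i M →
    Reach prog 175 M 175 (λ M' → Σ ℕ λ i' → (nn ∸ i' ≡ m) × Copying C i' M') 8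
  copy-step C i m M e cinv =
    step-sub refl (step-jz-suc refl (trans (cong₂ _∸_ c9 c5) e) (step-load refl (step-add refl (step-sub refl (step-add refl (step-store refl (step-jmp refl (done (suc i , e' , inv)))))))))
    where
      open Copying cinv
      i<n = proj₁ (countdown nn i e)
      e' = proj₂ (countdown nn i e)
      Y1 = write M 8 (M 9 ∸ M 5)
      Y2 = write Y1 7 (Y1 (M 5))
      Y3 = write Y2 6 (M 3 + M 5)
      Y4 = write Y3 6 ((M 3 + M 5) ∸ M 2)
      Y5 = write Y4 5 (M 5 + M 2)
      a = (M 3 + M 5) ∸ M 2
      Y6 = write Y5 a (Y1 (M 5))
      ea : a ≡ C + i
      ea = trans (cong₂ (λ x y → (x + y) ∸ M 2) c3 c5) (trans (cong ((C + suc i) ∸_) c2) (trans (cong (_∸ 1) (+-suc C i)) refl))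
      a34 : 34 ≤ a
      a34 = subst (34 ≤_) (sym ea) (≤-trans cC (m≤m+n C i))
      M5≥ : 9 ≤ M 5
      M5≥ = subst (9 ≤_) (sym c5) (s≤s (≤-trans (≤ᵇ⇒≤ 8 32 _) ci))
      rd : ∀ x → 9 ≤ x → Y5 x ≡ M x
      rd x h = trans (write-< Y4 5 _ x (≤-trans (s≤s (s≤s (s≤s (s≤s (s≤s (s≤s z≤n)))))) h))
        (trans (write-< Y3 6 _ x (≤-trans (s≤s (s≤s (s≤s (s≤s (s≤s (s≤s (s≤s z≤n))))))) h))
        (trans (write-< Y2 6 _ x (≤-trans (s≤s (s≤s (s≤s (s≤s (s≤s (s≤s (s≤s z≤n))))))) h))
        (trans (write-< Y1 7 _ x (≤-trans (s≤s (s≤s (s≤s (s≤s (s≤s (s≤s (s≤s (s≤s z≤n)))))))) h))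
        (write-< M 8 _ x (≤-trans (s≤s (s≤s (s≤s (s≤s (s≤s (s≤s (s≤s (s≤s (s≤s z≤n))))))))) h)))))
      loaded : Y1 (M 5) ≡ col i
      loaded = trans (write-< M 8 _ (M 5) M5≥) (trans (cong M c5) (cSrc (suc i) ≤-refl i<n))
      inv : Copying C (suc i) Y6
      inv = record
        { c2 = trans (write-> Y5 a _ 2 (small< (≤ᵇ⇒≤ 2 33 _) a34)) c2
        ; c3 = trans (write-> Y5 a _ 3 (small< (≤ᵇ⇒≤ 3 33 _) a34)) c3
        ; c4 = trans (write-> Y5 a _ 4 (small< (≤ᵇ⇒≤ 4 33 _) a34)) c4
        ; c9 = trans (write-> Y5 a _ 9 (small< (≤ᵇ⇒≤ 9 33 _) a34)) c9
        ; c5 = trans (write-> Y5 a _ 5 (small< (≤ᵇ⇒≤ 5 33 _) a34)) (trans (cong₂ _+_ c5 c2) (+-comm (suc i) 1))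
        ; cCol = cc
        ; cSrc = λ y h1 h2 → trans (write-> Y5 a _ y (≤-trans (s≤s h2) (≤-trans cn (≤-trans (m≤m+n C i) (≤-reflexive (sym ea))))))
                    (trans (rd y (≤-trans (≤ᵇ⇒≤ 9 32 _) (≤-trans ci (≤-trans (n≤1+n i) (≤-trans (n≤1+n (suc i)) h1))))) (cSrc y (≤-trans (n≤1+n (suc i)) h1) h2))
        ; cC = cC ; cn = cn ; ci = ≤-trans ci (n≤1+n i)
        }
        where
          cc : ∀ x → x < suc i → Y6 (C + x) ≡ col x
          cc x lt with m≤n⇒m<n∨m≡n (≤-pred lt)
          ... | inj₂ refl = trans (write-at {Y5} {a} {Y1 (M 5)} (sym ea)) loaded
          ... | inj₁ xi = trans (write-> Y5 a _ (C + x) (≤-trans (+-monoʳ-< C xi) (≤-reflexive (sym ea))))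
                            (trans (rd (C + x) (≤-trans (≤ᵇ⇒≤ 9 34 _) (≤-trans cC (m≤m+n C x)))) (cCol x xi))

  copy-exit : ∀ C i M → nn ∸ i ≡ 0 → Copying C i M → Reach prog 175 M 183 (Colours C) 2
  copy-exit C i M e cinv = step-sub refl (step-jz-zero refl (trans (cong₂ _∸_ c9 c5) e) (done b))
    where
      open Copying cinv
      Y1 = write M 8 (M 9 ∸ M 5)
      b : Colours C Y1
      b = record { b2 = c2 ; b3 = c3 ; b4 = c4 ; b9 = c9
                 ; bCol = λ x lt → trans (write-< M 8 _ (C + x) (small< (≤ᵇ⇒≤ 8 33 _) (≤-trans cC (m≤m+n C x)))) (cCol x (≤-trans lt (m∸n≡0⇒m≤n e)))
                 ; bC = cC ; bn = cn }

  copy-colours : ∀ C M → Copying C 32 M → Reach prog 175 M 183 (Colours C) ((nn ∸ 32) * 8 + 2)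
  copy-colours C M ci = loop (λ m M → Σ ℕ λ i → (nn ∸ i ≡ m) × Copying C i M) 8 2
    (λ M (i , e , c) → copy-exit C i M e c)
    (λ m M (i , e , c) → copy-step C i m M e c)
    (nn ∸ 32) M (32 , refl , ci)

module Tabulation (n' : ℕ) (c : Fin (suc n') → ℕ) where

  open import Data.Nat
  open import Data.Nat.Properties
  open import Data.Bool using (true; false; if_then_else_; T)
  open import Data.Product using (Σ; _×_; _,_; proj₁; proj₂)
  open import Data.Sum using (_⊎_; inj₁; inj₂)
  open import Data.Empty using (⊥-elim)
  open import Relation.Binary.PropositionalEquality
  open import Data.Nat.Tactic.RingSolver
  open Arithmetic
  open MECProgram
  open Memories
  open Hoare
  open Relocation n' c
  open Algorithm col

  -- The colours are at C + x, the tables best and back at C + n + x and C + 2n + 1 + x,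
  -- and the marks at C + 3n + 2 + x.
  record Registers (C : ℕ) (M : Memory) : Set where
    field
      f2 : M 2 ≡ 1
      f3 : M 3 ≡ C
      f4 : M 4 ≡ nn
      f9 : M 9 ≡ suc nn
      f10 : M 10 ≡ C + nn
      f11 : M 11 ≡ C + nn + suc nn
      f12 : M 12 ≡ C + nn + suc nn + suc nn
      f13 : M 13 ≡ 0
      fCol : ∀ x → x < nn → M (C + x) ≡ col x
      fC : 34 ≤ C
      fn : nn < C

  record Tables (C jj : ℕ) (M : Memory) : Set where
    field
      bestA : ∀ x → x ≤ jj → M (C + nn + x) ≡ proj₁ (tables jj) x
      backA : ∀ x → 1 ≤ x → x ≤ jj → M (C + nn + suc nn + x) ≡ proj₂ (tables jj) x

  Scratch : ℕ → Set
  Scratch r = (r ≡ 8 ⊎ 14 ≤ r) × r < 34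

  scratch-8 : Scratch 8
  scratch-8 = inj₁ refl , ≤ᵇ⇒≤ 9 34 _

  scratch : ∀ r → T (14 ≤ᵇ r) → T (r <ᵇ 34) → Scratch r
  scratch r 14≤r r<34 = inj₂ (≤ᵇ⇒≤ 14 r 14≤r) , <ᵇ⇒< r 34 r<34

  Scratch⇒≢ : ∀ {r k} → Scratch r → k ≤ 13 → k ≢ 8 → k ≢ r
  Scratch⇒≢ (inj₁ refl , _) _ k8 e = k8 e
  Scratch⇒≢ (inj₂ h , _) kl _ refl = <-irrefl refl (≤-trans (s≤s kl) h)

  Registers-write : ∀ {C M} r v → Scratch r → Registers C M → Registers C (write M r v)
  Registers-write {C} {M} r v w d = record
    { f2 = trans (write-≢ M r v 2 (Scratch⇒≢ w (≤ᵇ⇒≤ 2 13 _) (λ ()))) f2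
    ; f3 = trans (write-≢ M r v 3 (Scratch⇒≢ w (≤ᵇ⇒≤ 3 13 _) (λ ()))) f3
    ; f4 = trans (write-≢ M r v 4 (Scratch⇒≢ w (≤ᵇ⇒≤ 4 13 _) (λ ()))) f4
    ; f9 = trans (write-≢ M r v 9 (Scratch⇒≢ w (≤ᵇ⇒≤ 9 13 _) (λ ()))) f9
    ; f10 = trans (write-≢ M r v 10 (Scratch⇒≢ w (≤ᵇ⇒≤ 10 13 _) (λ ()))) f10
    ; f11 = trans (write-≢ M r v 11 (Scratch⇒≢ w (≤ᵇ⇒≤ 11 13 _) (λ ()))) f11
    ; f12 = trans (write-≢ M r v 12 (Scratch⇒≢ w (≤ᵇ⇒≤ 12 13 _) (λ ()))) f12
    ; f13 = trans (write-≢ M r v 13 (Scratch⇒≢ w (≤ᵇ⇒≤ 13 13 _) (λ ()))) f13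
    ; fCol = λ x lt → trans (write-< M r v (C + x) (<-≤-trans (proj₂ w) (≤-trans fC (m≤m+n C x)))) (fCol x lt)
    ; fC = fC ; fn = fn }
    where open Registers d

  Tables-write : ∀ {C jj M} r v → r < 34 → 34 ≤ C → Tables C jj M → Tables C jj (write M r v)
  Tables-write {C} {jj} {M} r v lt cC d = record
    { bestA = λ x h → trans (write-< M r v _ (<-≤-trans lt (≤-trans cC (≤-trans (m≤m+n C nn) (m≤m+n (C + nn) x))))) (bestA x h)
    ; backA = λ x h1 h2 → trans (write-< M r v _ (<-≤-trans lt (≤-trans cC (≤-trans (m≤m+n C nn) (≤-trans (m≤m+n (C + nn) (suc nn)) (m≤m+n _ x)))))) (backA x h1 h2) }
    where open Tables d

  record ScanRegisters (jj bj bk i tri len : ℕ) (M : Memory) : Set where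
    field
      r14 : M 14 ≡ suc jj
      r15 : M 15 ≡ bj
      r16 : M 16 ≡ bk
      r17 : M 17 ≡ i
      r18 : M 18 ≡ tri
      r19 : M 19 ≡ len

  ScanScratch : ℕ → Set
  ScanScratch r = (r ≡ 8 ⊎ 20 ≤ r) × r < 34

  ScanScratch⇒≢ : ∀ {r k} → ScanScratch r → 14 ≤ k → k ≤ 19 → k ≢ r
  ScanScratch⇒≢ (inj₁ refl , _) h _ e = ≤⇒≤ᵇ (subst (14 ≤_) e h)
  ScanScratch⇒≢ (inj₂ h , _) _ kl refl = <-irrefl refl (≤-trans (s≤s kl) h)

  ScanScratch⇒Scratch : ∀ {r} → ScanScratch r → Scratch r
  ScanScratch⇒Scratch (inj₁ e , l) = inj₁ e , l
  ScanScratch⇒Scratch (inj₂ h , l) = inj₂ (≤-trans (≤ᵇ⇒≤ 14 20 _) h) , l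

  ScanRegisters-write : ∀ {jj bj bk i tri len M} r v → ScanScratch r → ScanRegisters jj bj bk i tri len M → ScanRegisters jj bj bk i tri len (write M r v)
  ScanRegisters-write {M = M} r v w ir = record
    { r14 = trans (write-≢ M r v 14 (ScanScratch⇒≢ w (≤ᵇ⇒≤ 14 14 _) (≤ᵇ⇒≤ 14 19 _))) r14
    ; r15 = trans (write-≢ M r v 15 (ScanScratch⇒≢ w (≤ᵇ⇒≤ 14 15 _) (≤ᵇ⇒≤ 15 19 _))) r15
    ; r16 = trans (write-≢ M r v 16 (ScanScratch⇒≢ w (≤ᵇ⇒≤ 14 16 _) (≤ᵇ⇒≤ 16 19 _))) r16
    ; r17 = trans (write-≢ M r v 17 (ScanScratch⇒≢ w (≤ᵇ⇒≤ 14 17 _) (≤ᵇ⇒≤ 17 19 _))) r17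
    ; r18 = trans (write-≢ M r v 18 (ScanScratch⇒≢ w (≤ᵇ⇒≤ 14 18 _) (≤ᵇ⇒≤ 18 19 _))) r18
    ; r19 = trans (write-≢ M r v 19 (ScanScratch⇒≢ w (≤ᵇ⇒≤ 14 19 _) (≤ᵇ⇒≤ 19 19 _))) r19 }
    where open ScanRegisters ir

  record Scanning (C jj bj bk i tri len : ℕ) (M : Memory) : Set where
    field
      sdf : Registers C M
      sdp : Tables C jj M
      sir : ScanRegisters jj bj bk i tri len M

  Scanning-write : ∀ {C jj bj bk i tri len M} r v → ScanScratch r → Scanning C jj bj bk i tri len M → Scanning C jj bj bk i tri len (write M r v)
  Scanning-write r v w s = record { sdf = Registers-write r v (ScanScratch⇒Scratch w) (Scanning.sdf s) ; sdp = Tables-write r v (proj₂ w) (Registers.fC (Scanning.sdf s)) (Scanning.sdp s) ; sir = ScanRegisters-write r v w (Scanning.sir s) }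

  scan-scratch-8 : ScanScratch 8
  scan-scratch-8 = inj₁ refl , ≤ᵇ⇒≤ 9 34 _
  scan-scratch : ∀ r → T (20 ≤ᵇ r) → T (r <ᵇ 34) → ScanScratch r
  scan-scratch r a b = inj₂ (≤ᵇ⇒≤ 20 r a) , <ᵇ⇒< r 34 b

  occurs-loop : ∀ C jj bj bk i' tri len x m k M → suc jj ∸ k ≡ m → k ≤ suc jj → suc jj ≤ nn →
    Scanning C jj bj bk (suc i') tri len M → M 23 ≡ x → M 24 ≡ k →
    Reach prog 209 M (if occurs x k m then 223 else 219) (Scanning C jj bj bk (suc i') tri len) (m * 10 + 10)
  occurs-loop C jj bj bk i' tri len x zero k M e kj jn s e23 e24 =
    weaken-time (≤ᵇ⇒≤ 2 10 _) (step-sub refl (step-jz-zero refl (trans (cong₂ _∸_ (ScanRegisters.r14 (Scanning.sir s)) e24) e) (done (Scanning-write 8 _ scan-scratch-8 s))))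
  occurs-loop C jj bj bk i' tri len x (suc m) k M e kj jn s e23 e24 = step-sub refl (step-jz-suc refl (trans (cong₂ _∸_ (ScanRegisters.r14 (Scanning.sir s)) e24) e)
      (step-add refl (step-load refl (step-sub refl (step-sub refl (step-add refl (kbr (dist x (col k) ≡ᵇ 0) refl)))))))
    where
      open Registers (Scanning.sdf s)
      k<j = proj₁ (countdown (suc jj) k e)
      a = M 3 + M 24
      K1 = write M 8 (M 14 ∸ M 24)
      K2 = write K1 20 a
      K3 = write K2 25 (K2 a)
      K4 = write K3 26 (M 23 ∸ K2 a)
      K5 = write K4 27 (K2 a ∸ M 23)
      K6 = write K5 26 ((M 23 ∸ K2 a) + (K2 a ∸ M 23))
      ea : a ≡ C + k
      ea = cong₂ _+_ f3 e24
      a34 : 34 ≤ a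
      a34 = subst (34 ≤_) (sym ea) (≤-trans fC (m≤m+n C k))
      ck : K2 a ≡ col k
      ck = trans (write-< K1 20 a a (small< (≤ᵇ⇒≤ 20 33 _) a34)) (trans (write-< M 8 _ a (small< (≤ᵇ⇒≤ 8 33 _) a34)) (trans (cong M ea) (fCol k (<-≤-trans k<j jn))))
      dv : (M 23 ∸ K2 a) + (K2 a ∸ M 23) ≡ dist x (col k)
      dv = cong₂ (λ p q → (p ∸ q) + (q ∸ p)) e23 ck
      s6 : Scanning C jj bj bk (suc i') tri len K6
      s6 = Scanning-write 26 _ (scan-scratch 26 _ _) (Scanning-write 27 _ (scan-scratch 27 _ _)
          (Scanning-write 26 _ (scan-scratch 26 _ _) (Scanning-write 25 _ (scan-scratch 25 _ _)
          (Scanning-write 20 _ (scan-scratch 20 _ _) (Scanning-write 8 _ scan-scratch-8 s)))))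
      kbr : ∀ b → (dist x (col k) ≡ᵇ 0) ≡ b →
        Reach prog 216 K6 (if (if b then true else occurs x (suc k) m) then 223 else 219) (Scanning C jj bj bk (suc i') tri len) (3 + (m * 10 + 10))
      kbr true eq = weaken-time z≤n' (step-jz-zero refl (trans dv (≡ᵇ⇒≡ _ 0 (subst T (sym eq) _))) (done s6))
        where z≤n' : 1 ≤ 3 + (m * 10 + 10)
              z≤n' = s≤s z≤n
      kbr false eq with dist x (col k) in dq
      ... | zero = ⊥-elim (subst T eq _)
      ... | suc v = step-jz-suc refl (trans dv dq) (step-add refl (step-jmp refl
            (occurs-loop C jj bj bk i' tri len x m (suc k) _ (proj₂ (countdown (suc jj) k e)) k<j jn s8 e23 (trans (cong₂ _+_ e24 f2) (+-comm k 1)))))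
        where
          s8 = Scanning-write 24 _ (scan-scratch 24 _ _) s6

  keepBest-take : ∀ bj bk cand i → bj ∸ cand ≡ 0 → keepBest bj bk cand i ≡ (cand , i)
  keepBest-take bj bk cand i e rewrite e = refl

  keepBest-keep : ∀ bj bk cand i v → bj ∸ cand ≡ suc v → keepBest bj bk cand i ≡ (bj , bk)
  keepBest-keep bj bk cand i v e rewrite e = refl

  compare-split : ∀ C jj bj bk i tri len M → i ≤ jj → Scanning C jj bj bk i tri len M →
    Reach prog 196 M 204 (Scanning C jj (proj₁ (keepBest bj bk (proj₁ (tables jj) i + tri) i)) (proj₂ (keepBest bj bk (proj₁ (tables jj) i + tri) i)) i tri len) 8
  compare-split C jj bj bk i tri len M ij s = step-add refl (step-load refl (step-add refl (step-sub refl (br (bj ∸ cand) refl))))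
    where
      open Registers (Scanning.sdf s)
      open ScanRegisters (Scanning.sir s)
      bst = proj₁ (tables jj)
      cand = bst i + tri
      a = M 10 + M 17
      Z1 = write M 20 a
      Z2 = write Z1 21 (Z1 a)
      Z3 = write Z2 21 (Z1 a + M 18)
      Z4 = write Z3 22 (M 15 ∸ (Z1 a + M 18))
      ea : a ≡ C + nn + i
      ea = cong₂ _+_ f10 r17
      a34 : 34 ≤ a
      a34 = subst (34 ≤_) (sym ea) (≤-trans fC (≤-trans (m≤m+n C nn) (m≤m+n (C + nn) i)))
      eb : Z1 a ≡ bst i
      eb = trans (write-< M 20 a a (small< (≤ᵇ⇒≤ 20 33 _) a34)) (trans (cong M ea) (Tables.bestA (Scanning.sdp s) i ij))
      ec : Z1 a + M 18 ≡ cand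
      ec = cong₂ _+_ eb r18
      s4 : Scanning C jj bj bk i tri len Z4
      s4 = Scanning-write 22 _ (scan-scratch 22 _ _) (Scanning-write 21 _ (scan-scratch 21 _ _)
          (Scanning-write 21 _ (scan-scratch 21 _ _) (Scanning-write 20 _ (scan-scratch 20 _ _) s)))
      e22 : Z4 22 ≡ bj ∸ cand
      e22 = cong₂ _∸_ r15 ec
      br : ∀ v → bj ∸ cand ≡ v → Reach prog 200 Z4 204 (Scanning C jj (proj₁ (keepBest bj bk cand i)) (proj₂ (keepBest bj bk cand i)) i tri len) 4
      br zero e rewrite keepBest-take bj bk cand i e = step-jz-zero refl (trans e22 e) (step-add refl (step-add refl (done s6)))
        where
          Z5 = write Z4 15 ((Z1 a + M 18) + M 13)
          Z6 = write Z5 16 (M 17 + M 13)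
          s6 : Scanning C jj cand i i tri len Z6
          s6 = record
            { sdf = Registers-write 16 _ (scratch 16 _ _) (Registers-write 15 _ (scratch 15 _ _) (Scanning.sdf s4))
            ; sdp = Tables-write 16 _ (≤ᵇ⇒≤ 17 34 _) fC (Tables-write 15 _ (≤ᵇ⇒≤ 16 34 _) fC (Scanning.sdp s4))
            ; sir = record { r14 = r14 ; r15 = trans (cong₂ _+_ ec f13) (+-identityʳ cand) ; r16 = trans (cong₂ _+_ r17 f13) (+-identityʳ i)
                           ; r17 = r17 ; r18 = r18 ; r19 = r19 } }
      br (suc v) e rewrite keepBest-keep bj bk cand i v e = weaken-time (≤ᵇ⇒≤ 2 4 _) (step-jz-suc refl (trans e22 e) (step-jmp refl (done s4)))

  scan-stop : ∀ bst j i tri len bj bk → occurs (col i) (suc i) (j ∸ suc i) ≡ true →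
    scan bst j (suc i) tri len bj bk ≡ keepBest bj bk (bst (suc i) + tri) (suc i)
  scan-stop bst j i tri len bj bk e rewrite e = refl

  scan-continue : ∀ bst j i tri len bj bk → occurs (col i) (suc i) (j ∸ suc i) ≡ false →
    scan bst j (suc i) tri len bj bk ≡ scan bst j i (tri + len) (suc len) (proj₁ (keepBest bj bk (bst (suc i) + tri) (suc i))) (proj₂ (keepBest bj bk (bst (suc i) + tri) (suc i)))
  scan-continue bst j i tri len bj bk e rewrite e = refl

  Scanned : ℕ → ℕ → ℕ × ℕ → Memory → Set
  Scanned C jj res M = Registers C M × Tables C jj M × (M 14 ≡ suc jj) × (M 15 ≡ proj₁ res) × (M 16 ≡ proj₂ res)

  scanCost : ℕ
  scanCost = 30 + nn * 10

  scanned : ∀ {C jj bj bk i tri len M} → Scanning C jj bj bk i tri len M → Scanned C jj (bj , bk) M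
  scanned s = Scanning.sdf s , Scanning.sdp s , ScanRegisters.r14 (Scanning.sir s) , ScanRegisters.r15 (Scanning.sir s) , ScanRegisters.r16 (Scanning.sir s)

  scanned-≡ : ∀ {C jj r1 r2 M} → r1 ≡ r2 → Scanned C jj r1 M → Scanned C jj r2 M
  scanned-≡ refl p = p

  scan-cost-step : ∀ m X → m ≤ nn → 8 + (5 + ((m * 10 + 10) + (4 + X))) ≤ scanCost + X
  scan-cost-step m X le = ≤-trans (≤-reflexive (lem m X)) (≤-trans (+-monoʳ-≤ 27 (+-monoˡ-≤ X (*-monoˡ-≤ 10 le))) (≤-trans (+-monoˡ-≤ (nn * 10 + X) (≤ᵇ⇒≤ 27 30 _)) (≤-reflexive (sym (+-assoc 30 (nn * 10) X)))))
    where
      lem : ∀ m X → 8 + (5 + ((m * 10 + 10) + (4 + X))) ≡ 27 + (m * 10 + X)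
      lem = solve-∀

  scan-loop : ∀ C jj i tri len bj bk M → i ≤ jj → suc jj ≤ nn → Scanning C jj bj bk i tri len M →
    Reach prog 196 M 223 (Scanned C jj (scan (proj₁ (tables jj)) (suc jj) i tri len bj bk)) (suc i * scanCost)
  scan-loop C jj zero tri len bj bk M ij jn s =
    weaken-time (≤-trans (≤ᵇ⇒≤ 9 30 _) (≤-trans (m≤m+n 30 (nn * 10)) (m≤m+n scanCost 0)))
      (seq (compare-split C jj bj bk zero tri len M ij s) (λ M' s' → step-jz-zero refl (ScanRegisters.r17 (Scanning.sir s')) (done (scanned s'))))
  scan-loop C jj (suc i) tri len bj bk M ij jn s =
    weaken-time (scan-cost-step (suc jj ∸ suc i) (suc i * scanCost) mle) (seq (compare-split C jj bj bk (suc i) tri len M ij s) cont1)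
    where
      bst = proj₁ (tables jj)
      u = keepBest bj bk (bst (suc i) + tri) (suc i)
      bj' = proj₁ u
      bk' = proj₂ u
      m = suc jj ∸ suc i
      mle : m ≤ nn
      mle = ≤-trans (m∸n≤m (suc jj) (suc i)) jn
      res = scan bst (suc jj) (suc i) tri len bj bk
      cont1 : ∀ M4 → Scanning C jj bj' bk' (suc i) tri len M4 →
        Reach prog 204 M4 223 (Scanned C jj res) (5 + ((m * 10 + 10) + (4 + suc i * scanCost)))
      cont1 M4 s4 = step-jz-suc refl (ScanRegisters.r17 (Scanning.sir s4)) (step-add refl (step-sub refl (step-load refl (step-add refl
                      (cont2 (occurs (col i) (suc i) m) refl)))))
        where
          open Registers (Scanning.sdf s4)
          open ScanRegisters (Scanning.sir s4)
          b = (M4 3 + M4 17) ∸ M4 2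
          Q1 = write M4 20 (M4 3 + M4 17)
          Q2 = write Q1 20 b
          Q3 = write Q2 23 (Q2 b)
          Q4 = write Q3 24 (M4 17 + M4 13)
          eb : b ≡ C + i
          eb = trans (cong₂ (λ x y → (x + y) ∸ M4 2) f3 r17) (trans (cong ((C + suc i) ∸_) f2) (cong (_∸ 1) (+-suc C i)))
          b34 : 34 ≤ b
          b34 = subst (34 ≤_) (sym eb) (≤-trans fC (m≤m+n C i))
          i<n : i < nn
          i<n = ≤-trans (s≤s (≤-trans (n≤1+n i) ij)) jn
          e23 : Q2 b ≡ col i
          e23 = trans (write-< Q1 20 b b (small< (≤ᵇ⇒≤ 20 33 _) b34)) (trans (write-< M4 20 _ b (small< (≤ᵇ⇒≤ 20 33 _) b34)) (trans (cong M4 eb) (fCol i i<n)))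
          sQ : Scanning C jj bj' bk' (suc i) tri len Q4
          sQ = Scanning-write 24 _ (scan-scratch 24 _ _) (Scanning-write 23 _ (scan-scratch 23 _ _)
              (Scanning-write 20 _ (scan-scratch 20 _ _) (Scanning-write 20 _ (scan-scratch 20 _ _) s4)))
          kres : Reach prog 209 Q4 (if occurs (col i) (suc i) m then 223 else 219) (Scanning C jj bj' bk' (suc i) tri len) (m * 10 + 10)
          kres = occurs-loop C jj bj' bk' i tri len (col i) m (suc i) Q4 refl (≤-trans ij (n≤1+n jj)) jn sQ e23 (trans (cong₂ _+_ r17 f13) (+-identityʳ (suc i)))
          cont2 : ∀ bb → occurs (col i) (suc i) m ≡ bb → Reach prog 209 Q4 223 (Scanned C jj res) ((m * 10 + 10) + (4 + suc i * scanCost))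
          cont2 true eq = weaken-time (m≤m+n _ _) (weaken-post (λ M' s' → scanned-≡ (sym (scan-stop bst (suc jj) i tri len bj bk eq)) (scanned s'))
                            (subst (λ z → Reach prog 209 Q4 (if z then 223 else 219) (Scanning C jj bj' bk' (suc i) tri len) (m * 10 + 10)) eq kres))
          cont2 false eq = seq (subst (λ z → Reach prog 209 Q4 (if z then 223 else 219) (Scanning C jj bj' bk' (suc i) tri len) (m * 10 + 10)) eq kres) (λ M' s' →
            step-add refl (step-add refl (step-sub refl (step-jmp refl
              (weaken-post (λ M'' p → scanned-≡ (sym (scan-continue bst (suc jj) i tri len bj bk eq)) p)
                (scan-loop C jj i (tri + len) (suc len) bj' bk' _ (≤-trans (n≤1+n i) ij) jn (stepIS M' s')))))))
            where
              stepIS : ∀ M' → Scanning C jj bj' bk' (suc i) tri len M' →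
                Scanning C jj bj' bk' i (tri + len) (suc len) (write (write (write M' 18 (M' 18 + M' 19)) 19 (M' 19 + M' 2)) 17 (M' 17 ∸ M' 2))
              stepIS M' s' = record
                { sdf = Registers-write 17 _ (scratch 17 _ _) (Registers-write 19 _ (scratch 19 _ _) (Registers-write 18 _ (scratch 18 _ _) (Scanning.sdf s')))
                ; sdp = Tables-write 17 _ (≤ᵇ⇒≤ 18 34 _) (Registers.fC (Scanning.sdf s'))
                    (Tables-write 19 _ (≤ᵇ⇒≤ 20 34 _) (Registers.fC (Scanning.sdf s'))
                    (Tables-write 18 _ (≤ᵇ⇒≤ 19 34 _) (Registers.fC (Scanning.sdf s')) (Scanning.sdp s')))
                ; sir = record { r14 = ScanRegisters.r14 (Scanning.sir s') ; r15 = ScanRegisters.r15 (Scanning.sir s') ; r16 = ScanRegisters.r16 (Scanning.sir s')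
                               ; r17 = cong₂ _∸_ (ScanRegisters.r17 (Scanning.sir s')) (Registers.f2 (Scanning.sdf s'))
                               ; r18 = cong₂ _+_ (ScanRegisters.r18 (Scanning.sir s')) (ScanRegisters.r19 (Scanning.sir s'))
                               ; r19 = trans (cong₂ _+_ (ScanRegisters.r19 (Scanning.sir s')) (Registers.f2 (Scanning.sdf s'))) (+-comm len 1) } }

  Registers-write-high : ∀ {C M} a v → C + nn ≤ a → Registers C M → Registers C (write M a v)
  Registers-write-high {C} {M} a v h d = record
    { f2 = trans (write-> M a v 2 (small< (≤ᵇ⇒≤ 2 33 _) ca)) f2
    ; f3 = trans (write-> M a v 3 (small< (≤ᵇ⇒≤ 3 33 _) ca)) f3
    ; f4 = trans (write-> M a v 4 (small< (≤ᵇ⇒≤ 4 33 _) ca)) f4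
    ; f9 = trans (write-> M a v 9 (small< (≤ᵇ⇒≤ 9 33 _) ca)) f9
    ; f10 = trans (write-> M a v 10 (small< (≤ᵇ⇒≤ 10 33 _) ca)) f10
    ; f11 = trans (write-> M a v 11 (small< (≤ᵇ⇒≤ 11 33 _) ca)) f11
    ; f12 = trans (write-> M a v 12 (small< (≤ᵇ⇒≤ 12 33 _) ca)) f12
    ; f13 = trans (write-> M a v 13 (small< (≤ᵇ⇒≤ 13 33 _) ca)) f13
    ; fCol = λ x lt → trans (write-> M a v (C + x) (<-≤-trans (+-monoʳ-< C lt) h)) (fCol x lt)
    ; fC = fC ; fn = fn }
    where
      open Registers d
      ca : 34 ≤ a
      ca = ≤-trans fC (≤-trans (m≤m+n C nn) h)

  record Tabulating (C jj : ℕ) (M : Memory) : Set where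
    field
      jdf : Registers C M
      jdp : Tables C jj M
      j14 : M 14 ≡ suc jj
      jle : jj ≤ nn

  tabulate-init : ∀ C M → Colours C M → Reach prog 183 M 189 (Tabulating C 0) 6
  tabulate-init C M bs = step-add refl (step-add refl (step-add refl (step-set refl (step-store refl (step-set refl (done inv))))))
    where
      open Colours bs
      a = M 3 + M 4
      G1 = write M 10 a
      G2 = write G1 11 (a + M 9)
      G3 = write G2 12 ((a + M 9) + M 9)
      G4 = write G3 13 0
      G5 = write G4 a 0
      G6 = write G5 14 1
      ea : a ≡ C + nn
      ea = cong₂ _+_ b3 b4
      a34 : 34 ≤ a
      a34 = subst (34 ≤_) (sym ea) (≤-trans bC (m≤m+n C nn))
      df4 : Registers C G4
      df4 = record
        { f2 = b2 ; f3 = b3 ; f4 = b4 ; f9 = b9 ; f10 = ea ; f11 = cong₂ _+_ ea b9 ; f12 = cong₂ _+_ (cong₂ _+_ ea b9) b9 ; f13 = refl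
        ; fCol = λ x lt → trans (write-< G3 13 0 (C + x) (small< (≤ᵇ⇒≤ 13 33 _) (≤-trans bC (m≤m+n C x))))
                          (trans (write-< G2 12 _ (C + x) (small< (≤ᵇ⇒≤ 12 33 _) (≤-trans bC (m≤m+n C x))))
                          (trans (write-< G1 11 _ (C + x) (small< (≤ᵇ⇒≤ 11 33 _) (≤-trans bC (m≤m+n C x))))
                          (trans (write-< M 10 _ (C + x) (small< (≤ᵇ⇒≤ 10 33 _) (≤-trans bC (m≤m+n C x)))) (bCol x lt))))
        ; fC = bC ; fn = bn }
      inv : Tabulating C 0 G6
      inv = record
        { jdf = Registers-write 14 1 (scratch 14 _ _) (Registers-write-high a 0 (≤-reflexive (sym ea)) df4)
        ; jdp = record
            { bestA = λ { x z≤n → trans (write-< G5 14 1 (C + nn + 0) (small< (≤ᵇ⇒≤ 14 33 _) (≤-trans a34 (≤-reflexive (trans ea (sym (+-identityʳ _)))))))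
                                    (write-at {G4} {a} {0} (trans (+-identityʳ _) (sym ea))) }
            ; backA = λ { x (s≤s _) () } }
        ; j14 = refl
        ; jle = z≤n }

  store-split : ∀ C jj M → jj < nn → Scanned C jj (bestSplit jj) M → Reach prog 223 M 189 (Tabulating C (suc jj)) 6
  store-split C jj M jn (df , dp , e14 , e15 , e16) = step-add refl (step-add refl (step-add refl (step-store refl (step-store refl (step-jmp refl (done inv))))))
    where
      open Registers df
      open Tables dp
      D = C + nn
      E = C + nn + suc nn
      a1 = M 10 + M 14
      H1 = write M 20 a1
      H2 = write H1 21 (M 11 + M 14)
      H3 = write H2 14 (M 14 + M 2)
      H4 = write H3 a1 (M 15)
      H5 = write H4 (H4 21) (H4 16)
      e1 : a1 ≡ D + suc jj
      e1 = cong₂ _+_ f10 e14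
      D34 : 34 ≤ D
      D34 = ≤-trans fC (m≤m+n C nn)
      a134 : 34 ≤ a1
      a134 = subst (34 ≤_) (sym e1) (≤-trans D34 (m≤m+n D _))
      e21 : H4 21 ≡ E + suc jj
      e21 = trans (write-> H3 a1 _ 21 (small< (≤ᵇ⇒≤ 21 33 _) a134)) (cong₂ _+_ f11 e14)
      e16' : H4 16 ≡ M 16
      e16' = write-> H3 a1 _ 16 (small< (≤ᵇ⇒≤ 16 33 _) a134)
      D<E : ∀ x → x ≤ nn → D + x < E
      D<E x h = ≤-trans (s≤s (+-monoʳ-≤ D h)) (≤-reflexive (sym (+-suc D nn)))
      a2 = H4 21
      a234 : 34 ≤ a2
      a234 = subst (34 ≤_) (sym e21) (≤-trans D34 (≤-trans (m≤m+n D (suc nn)) (m≤m+n E _)))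
      rdH3 : ∀ y → 22 ≤ y → H3 y ≡ M y
      rdH3 y h = trans (write-< H2 14 _ y (≤-trans (≤ᵇ⇒≤ 15 22 _) h)) (trans (write-< H1 21 _ y h) (write-< M 20 _ y (≤-trans (≤ᵇ⇒≤ 21 22 _) h)))
      tb : ∀ x → x ≤ suc jj → H5 (D + x) ≡ proj₁ (tables (suc jj)) x
      tb x h = trans (write-> H4 a2 _ (D + x) (subst (D + x <_) (sym e21) (≤-trans (D<E x (≤-trans h jn)) (m≤m+n E _)))) (tb' x h)
        where
          tb' : ∀ x → x ≤ suc jj → H4 (D + x) ≡ proj₁ (tables (suc jj)) x
          tb' x h with m≤n⇒m<n∨m≡n h
          ... | inj₂ refl = trans (write-at {H3} {a1} {M 15} (sym e1)) (trans e15 (sym (write-≡ (proj₁ (tables jj)) (suc jj) _)))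
          ... | inj₁ lt = trans (write-> H3 a1 _ (D + x) (subst (D + x <_) (sym e1) (+-monoʳ-< D lt)))
                           (trans (rdH3 (D + x) (≤-trans (≤ᵇ⇒≤ 22 34 _) (≤-trans D34 (m≤m+n D x))))
                            (trans (bestA x (≤-pred lt)) (sym (write-≢ (proj₁ (tables jj)) (suc jj) _ x (λ q → <-irrefl q lt)))))
      tk : ∀ x → 1 ≤ x → x ≤ suc jj → H5 (E + x) ≡ proj₂ (tables (suc jj)) x
      tk x h1 h with m≤n⇒m<n∨m≡n h
      ... | inj₂ refl = trans (write-at {H4} {a2} {H4 16} (sym e21)) (trans e16' (trans e16 (sym (write-≡ (proj₂ (tables jj)) (suc jj) _))))
      ... | inj₁ lt = trans (write-> H4 a2 _ (E + x) (subst (E + x <_) (sym e21) (+-monoʳ-< E lt)))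
                       (trans (write-< H3 a1 _ (E + x) (subst (_< E + x) (sym e1) (≤-trans (D<E (suc jj) jn) (m≤m+n E x))))
                        (trans (rdH3 (E + x) (≤-trans (≤ᵇ⇒≤ 22 34 _) (≤-trans D34 (≤-trans (m≤m+n D (suc nn)) (m≤m+n E x)))))
                         (trans (backA x h1 (≤-pred lt)) (sym (write-≢ (proj₂ (tables jj)) (suc jj) _ x (λ q → <-irrefl q lt))))))
      df3 : Registers C H3
      df3 = Registers-write 14 _ (scratch 14 _ _) (Registers-write 21 _ (scratch 21 _ _) (Registers-write 20 _ (scratch 20 _ _) df))
      inv : Tabulating C (suc jj) H5
      inv = record
        { jdf = Registers-write-high a2 _ (≤-trans (m≤m+n D (suc nn)) (subst (E ≤_) (sym e21) (m≤m+n E _)))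
                  (Registers-write-high a1 _ (subst (D ≤_) (sym e1) (m≤m+n D _)) df3)
        ; jdp = record { bestA = tb ; backA = tk }
        ; j14 = trans (write-> H4 a2 _ 14 (small< (≤ᵇ⇒≤ 14 33 _) a234)) (trans (write-> H3 a1 _ 14 (small< (≤ᵇ⇒≤ 14 33 _) a134))
                  (trans (cong₂ _+_ e14 f2) (+-comm (suc jj) 1)))
        ; jle = jn }

  stepCost : ℕ
  stepCost = 13 + nn * scanCost

  tabulate-step : ∀ C jj m M → nn ∸ jj ≡ suc m → Tabulating C jj M → Reach prog 189 M 189 (λ M' → Σ ℕ λ jj' → (nn ∸ jj' ≡ m) × Tabulating C jj' M') stepCost
  tabulate-step C jj m M e ji =
    weaken-time bnd (step-sub refl (step-jz-suc refl (trans (cong₂ _∸_ f9 j14) e) (step-set refl (step-set refl (step-sub refl (step-set refl (step-set refl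
      (seq (scan-loop C jj jj 0 1 0 0 M7 ≤-refl jn s7) (λ M' p → weaken-post (λ M'' q → suc jj , e' , q) (store-split C jj M' jn p))))))))))
    where
      open Tabulating ji
      open Registers jdf
      jn = proj₁ (countdown nn jj e)
      e' = proj₂ (countdown nn jj e)
      W1 = write M 8 (M 9 ∸ M 14)
      W2 = write W1 15 0
      W3 = write W2 16 0
      W4 = write W3 17 (M 14 ∸ M 2)
      W5 = write W4 18 0
      M7 = write W5 19 1
      s7 : Scanning C jj 0 0 jj 0 1 M7
      s7 = record
        { sdf = Registers-write 19 _ (scratch 19 _ _) (Registers-write 18 _ (scratch 18 _ _)
            (Registers-write 17 _ (scratch 17 _ _) (Registers-write 16 _ (scratch 16 _ _) (Registers-write 15 _ (scratch 15 _ _)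
            (Registers-write 8 _ scratch-8 jdf)))))
        ; sdp = Tables-write 19 _ (≤ᵇ⇒≤ 20 34 _) fC (Tables-write 18 _ (≤ᵇ⇒≤ 19 34 _) fC (Tables-write 17 _ (≤ᵇ⇒≤ 18 34 _) fC
            (Tables-write 16 _ (≤ᵇ⇒≤ 17 34 _) fC (Tables-write 15 _ (≤ᵇ⇒≤ 16 34 _) fC (Tables-write 8 _ (≤ᵇ⇒≤ 9 34 _) fC jdp)))))
        ; sir = record { r14 = j14 ; r15 = refl ; r16 = refl ; r17 = cong₂ _∸_ j14 f2 ; r18 = refl ; r19 = refl } }
      bnd : 7 + (suc jj * scanCost + 6) ≤ stepCost
      bnd = ≤-trans (≤-reflexive (lem (suc jj * scanCost))) (+-monoʳ-≤ 13 (*-monoˡ-≤ scanCost jn))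
        where
          lem : ∀ X → 7 + (X + 6) ≡ 13 + X
          lem = solve-∀

  Tabulated : ℕ → Memory → Set
  Tabulated C M = Registers C M × Tables C nn M

  tabulate-exit : ∀ C jj M → nn ∸ jj ≡ 0 → Tabulating C jj M → Reach prog 189 M 229 (Tabulated C) 2
  tabulate-exit C jj M e ji = step-sub refl (step-jz-zero refl (trans (cong₂ _∸_ f9 j14) e)
    (done (Registers-write 8 (M 9 ∸ M 14) scratch-8 jdf , subst (λ z → Tables C z (write M 8 (M 9 ∸ M 14))) jeq (Tables-write 8 (M 9 ∸ M 14) (≤ᵇ⇒≤ 9 34 _) fC jdp))))
    where
      open Tabulating ji
      open Registers jdf
      jeq : jj ≡ nn
      jeq = ≤-antisym jle (m∸n≡0⇒m≤n e)

  tabulate : ∀ C M → Colours C M → Reach prog 183 M 229 (Tabulated C) (6 + (nn * stepCost + 2))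
  tabulate C M bs = seq (tabulate-init C M bs) (λ M' ji →
    loop (λ m M → Σ ℕ λ jj → (nn ∸ jj ≡ m) × Tabulating C jj M) stepCost 2
      (λ M (jj , e , j) → tabulate-exit C jj M e j)
      (λ m M (jj , e , j) → tabulate-step C jj m M e j)
      nn M' (0 , refl , ji))

-- The marks are output into M[n − 1], …, M[1]; the cells below 33 are registers of the
-- output loop, so they are filled last, by straight-line code addressing through M[0].
module Output (n' : ℕ) (c : Fin (suc n') → ℕ) where

  open import Data.Nat
  open import Data.Nat.Properties
  open import Data.Product using (Σ; _×_; _,_; proj₁; proj₂)
  open import Data.Sum using (inj₁; inj₂)
  open import Data.Empty using (⊥-elim)
  open import Relation.Binary.PropositionalEquality
  open import Relation.Nullary using (yes; no)
  open import Data.Nat.Tactic.RingSolver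
  open Arithmetic
  open MECProgram
  open Memories
  open Hoare
  open Relocation n' c
  open Tabulation n' c
  open Algorithm col
  open Optimality col using (best-good; tables-back; back)

  module _ (C : ℕ) where
    D = C + nn
    E = C + nn + suc nn
    F = C + nn + suc nn + suc nn

    F≥ : ∀ x → x ≤ nn → E + x < F
    F≥ x h = ≤-trans (s≤s (+-monoʳ-≤ E h)) (≤-reflexive (sym (+-suc E nn)))

    E≥ : ∀ x → x ≤ nn → D + x < E
    E≥ x h = ≤-trans (s≤s (+-monoʳ-≤ D h)) (≤-reflexive (sym (+-suc D nn)))

    C≤F : C ≤ F
    C≤F = ≤-trans (m≤m+n C nn) (≤-trans (m≤m+n D (suc nn)) (m≤m+n E (suc nn)))

    C≤F+ : ∀ x → C ≤ F + x
    C≤F+ x = ≤-trans C≤F (m≤m+n F x)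

    Tables-write-high : ∀ {jj M} a v → F ≤ a → Tables C jj M → jj ≤ nn → Tables C jj (write M a v)
    Tables-write-high {jj} {M} a v h d jn = record
      { bestA = λ x hx → trans (write-> M a v (D + x) (<-≤-trans (E≥ x (≤-trans hx jn)) (≤-trans (m≤m+n E (suc nn)) h))) (bestA x hx)
      ; backA = λ x h1 h2 → trans (write-> M a v (E + x) (<-≤-trans (F≥ x (≤-trans h2 jn)) h)) (backA x h1 h2) }
      where open Tables d

    record Clearing (q : ℕ) (M : Memory) : Set where
      field
        mdf : Registers C M
        mdp : Tables C nn M
        m24 : M 24 ≡ q
        mz : ∀ x → x < q → M (F + x) ≡ 0
        mq : q ≤ suc nn

    clear-step : ∀ q m M → suc nn ∸ q ≡ suc m → Clearing q M → Reach prog 230 M 230 (λ M' → Σ ℕ λ q' → (suc nn ∸ q' ≡ m) × Clearing q' M') 6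
    clear-step q m M e mi = step-sub refl (step-jz-suc refl (trans (cong₂ _∸_ f9 m24) e) (step-add refl (step-add refl (step-store refl (step-jmp refl (done (suc q , e' , inv)))))))
      where
        open Clearing mi
        open Registers mdf
        q<n = proj₁ (countdown (suc nn) q e)
        e' = proj₂ (countdown (suc nn) q e)
        a = M 12 + M 24
        Y1 = write M 8 (M 9 ∸ M 24)
        Y2 = write Y1 20 a
        Y3 = write Y2 24 (M 24 + M 2)
        Y4 = write Y3 a (M 13)
        ea : a ≡ F + q
        ea = cong₂ _+_ f12 m24
        F34 : 34 ≤ F
        F34 = ≤-trans fC C≤F
        a34 : 34 ≤ a
        a34 = subst (34 ≤_) (sym ea) (≤-trans F34 (m≤m+n F q))
        df3 : Registers C Y3
        df3 = Registers-write 24 _ (scratch 24 _ _) (Registers-write 20 _ (scratch 20 _ _) (Registers-write 8 _ scratch-8 mdf))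
        dp3 : Tables C nn Y3
        dp3 = Tables-write 24 _ (≤ᵇ⇒≤ 25 34 _) fC (Tables-write 20 _ (≤ᵇ⇒≤ 21 34 _) fC (Tables-write 8 _ (≤ᵇ⇒≤ 9 34 _) fC mdp))
        rd3 : ∀ y → 25 ≤ y → Y3 y ≡ M y
        rd3 y h = trans (write-< Y2 24 _ y h) (trans (write-< Y1 20 _ y (≤-trans (≤ᵇ⇒≤ 21 25 _) h)) (write-< M 8 _ y (≤-trans (≤ᵇ⇒≤ 9 25 _) h)))
        inv : Clearing (suc q) Y4
        inv = record
          { mdf = Registers-write-high a _ (subst (D ≤_) (sym ea) (≤-trans (m≤m+n D (suc nn)) (≤-trans (m≤m+n E (suc nn)) (m≤m+n F q)))) df3
          ; mdp = Tables-write-high a _ (subst (F ≤_) (sym ea) (m≤m+n F q)) dp3 ≤-refl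
          ; m24 = trans (write-> Y3 a _ 24 (small< (≤ᵇ⇒≤ 24 33 _) a34)) (trans (cong₂ _+_ m24 f2) (+-comm q 1))
          ; mz = mz'
          ; mq = q<n }
          where
            mz' : ∀ x → x < suc q → Y4 (F + x) ≡ 0
            mz' x lt with m≤n⇒m<n∨m≡n (≤-pred lt)
            ... | inj₂ refl = trans (write-at {Y3} {a} {M 13} (sym ea)) f13
            ... | inj₁ xl = trans (write-> Y3 a _ (F + x) (subst (F + x <_) (sym ea) (+-monoʳ-< F xl)))
                              (trans (rd3 (F + x) (≤-trans (≤ᵇ⇒≤ 25 34 _) (≤-trans F34 (m≤m+n F x)))) (mz x xl))

    Cleared : Memory → Set
    Cleared M = Registers C M × Tables C nn M × (∀ x → x ≤ nn → M (F + x) ≡ 0)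

    clear-exit : ∀ q M → suc nn ∸ q ≡ 0 → Clearing q M → Reach prog 230 M 236 Cleared 2
    clear-exit q M e mi = step-sub refl (step-jz-zero refl (trans (cong₂ _∸_ f9 m24) e)
        (done (Registers-write 8 _ scratch-8 mdf , Tables-write 8 _ (≤ᵇ⇒≤ 9 34 _) fC mdp ,
               λ x h → trans (write-< M 8 _ (F + x) (small< (≤ᵇ⇒≤ 8 33 _) (≤-trans fC (C≤F+ x))))
                       (mz x (≤-trans (s≤s h) (m∸n≡0⇒m≤n e))))))
      where
        open Clearing mi
        open Registers mdf

    clear-marks : ∀ M → Tabulated C M → Reach prog 229 M 236 Cleared (1 + (suc nn * 6 + 2))
    clear-marks M (df , dp) = step-set refl (loop (λ m M → Σ ℕ λ q → (suc nn ∸ q ≡ m) × Clearing q M) 6 2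
       (λ M (q , e , mi) → clear-exit q M e mi)
       (λ m M (q , e , mi) → clear-step q m M e mi)
       (suc nn) _ (0 , refl , record { mdf = Registers-write 24 0 (scratch 24 _ _) df ; mdp = Tables-write 24 0 (≤ᵇ⇒≤ 25 34 _) (Registers.fC df) dp
                                          ; m24 = refl ; mz = λ x () ; mq = z≤n }))

    bck : ℕ → ℕ
    bck = proj₂ (tables nn)

    back< : ∀ j → 1 ≤ j → j ≤ nn → bck j < j
    back< (suc j) _ h = subst (_< suc j) (sym (tables-back nn (suc j) h)) (proj₁ (proj₂ (best-good j)))

    record Marking (j : ℕ) (mk : ℕ → ℕ) (M : Memory) : Set where
      field
        rdf : Registers C M
        rdp : Tables C nn M
        r14' : M 14 ≡ j
        rj : j ≤ nn
        rmk : ∀ x → x ≤ nn → M (F + x) ≡ mk x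

    Marked : (ℕ → ℕ) → Memory → Set
    Marked mk M = Registers C M × (∀ x → x ≤ nn → M (F + x) ≡ mk x)

    mark-loop : ∀ f j mk M → j ≤ f → Marking j mk M → Reach prog 237 M 244 (Marked (reconstruct bck f j mk)) (f * 7 + 1)
    mark-loop zero zero mk M _ ri = step-jz-zero refl (Marking.r14' ri) (done (Marking.rdf ri , Marking.rmk ri))
    mark-loop (suc f) zero mk M _ ri = weaken-time (s≤s z≤n) (step-jz-zero refl (Marking.r14' ri) (done (Marking.rdf ri , Marking.rmk ri)))
    mark-loop (suc f) (suc j) mk M (s≤s jf) ri =
      step-jz-suc refl r14' (step-add refl (step-load refl (step-add refl (step-add refl (step-store refl (step-jmp refl
        (mark-loop f i (write mk i 1) _ (≤-pred (≤-trans il (s≤s jf))) inv)))))))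
      where
        open Marking ri
        open Registers rdf
        i = bck (suc j)
        il : i < suc j
        il = back< (suc j) (s≤s z≤n) rj
        i≤n : i ≤ nn
        i≤n = ≤-trans (≤-pred (≤-trans il (s≤s ≤-refl))) (≤-trans (n≤1+n j) rj)
        a1 = M 11 + M 14
        R1 = write M 20 a1
        R2 = write R1 17 (R1 a1)
        b = M 12 + R1 a1
        R3 = write R2 20 b
        R4 = write R3 14 (R1 a1 + M 13)
        R5 = write R4 b (M 2)
        e1 : a1 ≡ E + suc j
        e1 = cong₂ _+_ f11 r14'
        E34 : 34 ≤ E
        E34 = ≤-trans fC (≤-trans (m≤m+n C nn) (m≤m+n D (suc nn)))
        F34 : 34 ≤ F
        F34 = ≤-trans E34 (m≤m+n E (suc nn))
        a134 : 34 ≤ a1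
        a134 = subst (34 ≤_) (sym e1) (≤-trans E34 (m≤m+n E _))
        ei : R1 a1 ≡ i
        ei = trans (write-< M 20 a1 a1 (small< (≤ᵇ⇒≤ 20 33 _) a134)) (trans (cong M e1) (Tables.backA rdp (suc j) (s≤s z≤n) rj))
        eb : b ≡ F + i
        eb = cong₂ _+_ f12 ei
        b34 : 34 ≤ b
        b34 = subst (34 ≤_) (sym eb) (≤-trans F34 (m≤m+n F i))
        df4 : Registers C R4
        df4 = Registers-write 14 _ (scratch 14 _ _) (Registers-write 20 _ (scratch 20 _ _) (Registers-write 17 _ (scratch 17 _ _)
            (Registers-write 20 _ (scratch 20 _ _) rdf)))
        dp4 : Tables C nn R4
        dp4 = Tables-write 14 _ (≤ᵇ⇒≤ 15 34 _) fC (Tables-write 20 _ (≤ᵇ⇒≤ 21 34 _) fC (Tables-write 17 _ (≤ᵇ⇒≤ 18 34 _) fC (Tables-write 20 _ (≤ᵇ⇒≤ 21 34 _) fC rdp)))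
        rd4 : ∀ y → 21 ≤ y → R4 y ≡ M y
        rd4 y h = trans (write-< R3 14 _ y (≤-trans (≤ᵇ⇒≤ 15 21 _) h)) (trans (write-< R2 20 _ y h)
                   (trans (write-< R1 17 _ y (≤-trans (≤ᵇ⇒≤ 18 21 _) h)) (write-< M 20 _ y h)))
        inv : Marking i (write mk i 1) R5
        inv = record
          { rdf = Registers-write-high b _ (subst (D ≤_) (sym eb) (≤-trans (m≤m+n D (suc nn)) (≤-trans (m≤m+n E (suc nn)) (m≤m+n F i)))) df4
          ; rdp = Tables-write-high b _ (subst (F ≤_) (sym eb) (m≤m+n F i)) dp4 ≤-refl
          ; r14' = trans (write-> R4 b _ 14 (small< (≤ᵇ⇒≤ 14 33 _) b34)) (trans (cong₂ _+_ ei f13) (+-identityʳ i))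
          ; rj = i≤n
          ; rmk = mkp }
          where
            mkp : ∀ x → x ≤ nn → R5 (F + x) ≡ write mk i 1 x
            mkp x h with x ≟ i
            ... | yes refl = trans (write-at {R4} {b} {M 2} (sym eb)) (trans f2 (sym (write-≡ mk x 1)))
            ... | no x≢i = trans (write-≢ R4 b _ (F + x) (λ q → x≢i (+-cancelˡ-≡ F x i (trans q eb))))
                           (trans (rd4 (F + x) (≤-trans (≤ᵇ⇒≤ 21 34 _) (≤-trans F34 (m≤m+n F x))))
                            (trans (rmk x h) (sym (write-≢ mk i 1 x x≢i))))

    Registers-write-input : ∀ {M} a v → 33 ≤ a → a < C → Registers C M → Registers C (write M a v)
    Registers-write-input {M} a v h1 h2 d = record
      { f2 = trans (write-> M a v 2 (≤-trans (≤ᵇ⇒≤ 3 33 _) h1)) f2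
      ; f3 = trans (write-> M a v 3 (≤-trans (≤ᵇ⇒≤ 4 33 _) h1)) f3
      ; f4 = trans (write-> M a v 4 (≤-trans (≤ᵇ⇒≤ 5 33 _) h1)) f4
      ; f9 = trans (write-> M a v 9 (≤-trans (≤ᵇ⇒≤ 10 33 _) h1)) f9
      ; f10 = trans (write-> M a v 10 (≤-trans (≤ᵇ⇒≤ 11 33 _) h1)) f10
      ; f11 = trans (write-> M a v 11 (≤-trans (≤ᵇ⇒≤ 12 33 _) h1)) f11
      ; f12 = trans (write-> M a v 12 (≤-trans (≤ᵇ⇒≤ 13 33 _) h1)) f12
      ; f13 = trans (write-> M a v 13 (≤-trans (≤ᵇ⇒≤ 14 33 _) h1)) f13
      ; fCol = λ x lt → trans (write-< M a v (C + x) (≤-trans h2 (m≤m+n C x))) (fCol x lt)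
      ; fC = fC ; fn = fn }
      where open Registers d

    module O (mk : ℕ → ℕ) where
      record Emitting (r : ℕ) (M : Memory) : Set where
        field
          odf : Registers C M
          o14 : M 14 ≡ r
          o29 : M 29 ≡ 32
          orn : r < nn
          omk : ∀ x → x ≤ nn → M (F + x) ≡ mk x
          oout : ∀ y → r < y → y < nn → M y ≡ mk y

      emit-step : ∀ r m M → r ∸ 32 ≡ suc m → Emitting r M → Reach prog 246 M 246 (λ M' → Σ ℕ λ r' → (r' ∸ 32 ≡ m) × Emitting r' M') 8
      emit-step r m M e oi = step-sub refl (step-jz-suc refl (trans (cong₂ _∸_ o14 o29) e) (step-add refl (step-load refl (step-add refl (step-sub refl (step-store refl (step-jmp refl (done (r ∸ 1 , e' , inv)))))))))
        where
          open Emitting oi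
          open Registers odf
          r33 = proj₁ (countdown r 32 e)
          e' : (r ∸ 1) ∸ 32 ≡ m
          e' = trans (∸-+-assoc r 1 32) (proj₂ (countdown r 32 e))
          b = M 12 + M 14
          O1 = write M 8 (M 14 ∸ M 29)
          O2 = write O1 20 b
          O3 = write O2 21 (O2 b)
          O4 = write O3 22 (M 14 + M 13)
          O5 = write O4 14 (M 14 ∸ M 2)
          t = M 14 + M 13
          O6 = write O5 t (O2 b)
          eb : b ≡ F + r
          eb = cong₂ _+_ f12 o14
          F34 : 34 ≤ F
          F34 = ≤-trans fC C≤F
          b34 : 34 ≤ b
          b34 = subst (34 ≤_) (sym eb) (≤-trans F34 (m≤m+n F r))
          ev : O2 b ≡ mk r
          ev = trans (write-< O1 20 b b (small< (≤ᵇ⇒≤ 20 33 _) b34)) (trans (write-< M 8 _ b (small< (≤ᵇ⇒≤ 8 33 _) b34)) (trans (cong M eb) (omk r (<⇒≤ orn))))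
          et : t ≡ r
          et = trans (cong₂ _+_ o14 f13) (+-identityʳ r)
          t33 : 33 ≤ t
          t33 = subst (33 ≤_) (sym et) r33
          rC : r < C
          rC = <-trans orn fn
          tC : t < C
          tC = subst (_< C) (sym et) rC
          rd5 : ∀ y → 23 ≤ y → O5 y ≡ M y
          rd5 y h = trans (write-< O4 14 _ y (≤-trans (≤ᵇ⇒≤ 15 23 _) h)) (trans (write-< O3 22 _ y h)
                       (trans (write-< O2 21 _ y (≤-trans (≤ᵇ⇒≤ 22 23 _) h)) (trans (write-< O1 20 _ y (≤-trans (≤ᵇ⇒≤ 21 23 _) h))
                        (write-< M 8 _ y (≤-trans (≤ᵇ⇒≤ 9 23 _) h)))))
          inv : Emitting (r ∸ 1) O6
          inv = record
            { odf = Registers-write-input t _ t33 tC (Registers-write 14 _ (scratch 14 _ _) (Registers-write 22 _ (scratch 22 _ _)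
                (Registers-write 21 _ (scratch 21 _ _) (Registers-write 20 _ (scratch 20 _ _)
                (Registers-write 8 _ scratch-8 odf)))))
            ; o14 = trans (write-> O5 t _ 14 (≤-trans (≤ᵇ⇒≤ 15 33 _) t33)) (cong₂ _∸_ o14 f2)
            ; o29 = trans (write-> O5 t _ 29 (≤-trans (≤ᵇ⇒≤ 30 33 _) t33)) o29
            ; orn = ≤-trans (s≤s (m∸n≤m r 1)) orn
            ; omk = λ x h → trans (write-< O5 t _ (F + x) (<-≤-trans tC (C≤F+ x)))
                             (trans (rd5 (F + x) (≤-trans (≤ᵇ⇒≤ 23 34 _) (≤-trans F34 (m≤m+n F x)))) (omk x h))
            ; oout = out }
            where
              lp : ∀ r y → 1 ≤ r → r ∸ 1 < y → r ≤ y
              lp (suc r) y _ a = a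
              out : ∀ y → r ∸ 1 < y → y < nn → O6 y ≡ mk y
              out y a h with y ≟ r
              ... | yes refl = trans (write-at {O5} {t} {O2 b} (sym et)) ev
              ... | no y≢r = trans (write-≢ O5 t _ y (λ q → y≢r (trans q et)))
                             (trans (rd5 y (≤-trans (≤ᵇ⇒≤ 23 33 _) (≤-trans r33 ry)))
                              (oout y (≤∧≢⇒< ry (λ q → y≢r (sym q))) h))
                where
                  ry : r ≤ y
                  ry = lp r y (≤-trans (s≤s z≤n) r33) a

      record EmittingLow (r : ℕ) (M : Memory) : Set where
        field
          t0 : M 0 ≡ F + r
          t1 : M 1 ≡ 1
          tmk : ∀ x → x ≤ nn → M (F + x) ≡ mk x
          tout : ∀ y → 33 ≤ y → y < nn → M y ≡ mk y
          tld : ∀ y → r < y → y ≤ 32 → y < nn → M y ≡ mk y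
          tF : 34 ≤ F

      Emitted : Memory → Set
      Emitted M = ∀ e → suc e < nn → M (suc e) ≡ mk (suc e)

      emit-exit : ∀ r M → r ∸ 32 ≡ 0 → Emitting r M → Reach prog 246 M 257 (EmittingLow 32) 5
      emit-exit r M e oi = step-sub refl (step-jz-zero refl (trans (cong₂ _∸_ o14 o29) e) (step-set refl (step-set refl (step-add refl (done inv)))))
        where
          open Emitting oi
          open Registers odf
          U = write M 8 (M 14 ∸ M 29)
          T3 = write (write (write U 1 1) 30 32) 0 (M 12 + 32)
          F34 : 34 ≤ F
          F34 = ≤-trans fC C≤F
          r32 : r ≤ 32
          r32 = m∸n≡0⇒m≤n e
          rdT : ∀ y → 31 ≤ y → T3 y ≡ M y
          rdT y h = trans (write-< (write (write U 1 1) 30 32) 0 _ y (≤-trans (s≤s z≤n) h)) (trans (write-< (write U 1 1) 30 32 y h)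
                      (trans (write-< U 1 1 y (≤-trans (≤ᵇ⇒≤ 2 31 _) h)) (write-< M 8 _ y (≤-trans (≤ᵇ⇒≤ 9 31 _) h))))
          inv : EmittingLow 32 T3
          inv = record
            { t0 = cong (_+ 32) f12
            ; t1 = refl
            ; tmk = λ x h → trans (rdT (F + x) (≤-trans (≤ᵇ⇒≤ 31 34 _) (≤-trans F34 (m≤m+n F x)))) (omk x h)
            ; tout = λ y a h → trans (rdT y (≤-trans (≤ᵇ⇒≤ 31 33 _) a)) (oout y (≤-trans (s≤s r32) a) h)
            ; tld = λ y a b _ → ⊥-elim (<-irrefl refl (≤-trans a b))
            ; tF = F34 }

      fetch-emit-load : ∀ t → t < 31 → fetch prog (257 + 2 * t) ≡ load 0 (32 ∸ t)
      fetch-emit-load t lt = trans (fetch-drop prog 257 (2 * t)) (fetch-twice-even (λ t → load 0 (32 ∸ t)) (λ _ → sub 0 1 0) 31 _ t lt)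

      fetch-emit-sub : ∀ t → t < 31 → fetch prog (258 + 2 * t) ≡ sub 0 1 0
      fetch-emit-sub t lt = trans (fetch-drop prog 257 (suc (2 * t))) (fetch-twice-odd (λ t → load 0 (32 ∸ t)) (λ _ → sub 0 1 0) 31 _ t lt)

      emit-pc : ∀ r → suc (suc r) ≤ 32 → suc (suc (257 + 2 * (32 ∸ suc (suc r)))) ≡ 257 + 2 * (32 ∸ suc r)
      emit-pc r h = cong (257 +_) (trans (sym (*-suc 2 (32 ∸ suc (suc r)))) (cong (2 *_) (sym (∸-suc 32 (suc r) h))))

      emit-low : ∀ r M → 1 ≤ r → r ≤ 32 → EmittingLow r M → Reach prog (257 + 2 * (32 ∸ r)) M 320 Emitted (2 * r)
      emit-low (suc zero) M _ _ ti = weaken-time (s≤s z≤n) (step-load refl (done fin))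
        where
          open EmittingLow ti
          X1 = write M 1 (M (M 0))
          fin : Emitted X1
          fin zero h = trans (write-≡ M 1 (M (M 0))) (trans (cong M t0) (tmk 1 (<⇒≤ h)))
          fin (suc e) h = trans (write-< M 1 (M (M 0)) (suc (suc e)) (s≤s (s≤s z≤n))) (sub' (suc (suc e)) (s≤s (s≤s z≤n)) h)
            where
              sub' : ∀ y → 2 ≤ y → y < nn → M y ≡ mk y
              sub' y y2 h2 with y ≤? 32
              ... | yes y32 = tld y y2 y32 h2
              ... | no n32 = tout y (≰⇒> n32) h2
      emit-low (suc (suc r)) M _ r32 ti =
        weaken-time (≤-reflexive (lem r))
         (step-load (trans (fetch-emit-load (32 ∸ R) lt31) (cong (load 0) (m∸[m∸n]≡n r32)))
          (step-sub (fetch-emit-sub (32 ∸ R) lt31) (at-pc (emit-pc r r32) (emit-low (suc r) X2 (s≤s z≤n) (≤-trans (n≤1+n _) r32) inv))))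
        where
          open EmittingLow ti
          R = suc (suc r)
          lem : ∀ r → 2 + 2 * suc r ≡ 2 * suc (suc r)
          lem = solve-∀
          lt31 : 32 ∸ R < 31
          lt31 = ≤-trans (s≤s (∸-monoʳ-≤ 32 (s≤s (s≤s (z≤n {r}))))) ≤-refl
          X1 = write M R (M (M 0))
          X2 = write X1 0 (X1 0 ∸ X1 1)
          R≤ : ∀ {y} → 33 ≤ y → R < y
          R≤ h = ≤-trans (s≤s r32) h
          inv : EmittingLow (suc r) X2
          inv = record
            { t0 = trans (cong₂ _∸_ (trans (write-> M R (M (M 0)) 0 (s≤s z≤n)) t0) (trans (write-> M R (M (M 0)) 1 (s≤s (s≤s z≤n))) t1)) (+-∸-assoc F (s≤s (z≤n {suc r})))
            ; t1 = trans (write-> M R (M (M 0)) 1 (s≤s (s≤s z≤n))) t1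
            ; tmk = λ x h → trans (write-< X1 0 (X1 0 ∸ X1 1) (F + x) (≤-trans (s≤s z≤n) (≤-trans tF (m≤m+n F x))))
                              (trans (write-< M R (M (M 0)) (F + x) (R≤ (≤-trans (≤ᵇ⇒≤ 33 34 _) (≤-trans tF (m≤m+n F x))))) (tmk x h))
            ; tout = λ y a h → trans (write-< X1 0 (X1 0 ∸ X1 1) y (≤-trans (s≤s z≤n) a)) (trans (write-< M R (M (M 0)) y (R≤ a)) (tout y a h))
            ; tld = ld
            ; tF = tF }
            where
              ld : ∀ y → suc r < y → y ≤ 32 → y < nn → X2 y ≡ mk y
              ld y a b h with y ≟ R
              ... | yes refl = trans (write-< X1 0 (X1 0 ∸ X1 1) R (s≤s z≤n)) (trans (write-≡ M R (M (M 0))) (trans (cong M t0) (tmk R (<⇒≤ h))))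
              ... | no y≢R = trans (write-< X1 0 (X1 0 ∸ X1 1) y (≤-trans (s≤s z≤n) a)) (trans (write-< M R (M (M 0)) y (≤∧≢⇒< a (λ q → y≢R (sym q)))) (tld y (≤∧≢⇒< a (λ q → y≢R (sym q))) b h))

    marks : ℕ → ℕ
    marks = reconstruct bck nn nn (λ _ → 0)

    open O marks

    emit-high : ∀ M → Emitting (nn ∸ 1) M → Reach prog 246 M 257 (EmittingLow 32) (((nn ∸ 1) ∸ 32) * 8 + 5)
    emit-high M oi = loop (λ m M → Σ ℕ λ r → (r ∸ 32 ≡ m) × Emitting r M) 8 5
       (λ M (r , e , o) → emit-exit r M e o)
       (λ m M (r , e , o) → emit-step r m M e o)
       ((nn ∸ 1) ∸ 32) M (nn ∸ 1 , refl , oi)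

    T3 : ℕ
    T3 = (1 + (suc nn * 6 + 2)) + ((1 + (nn * 7 + 1)) + ((2 + (((nn ∸ 1) ∸ 32) * 8 + 5)) + 64))

    output : ∀ M → Tabulated C M → Reach prog 229 M 320 Emitted T3
    output M dd = seq (clear-marks M dd) (λ M1 (df , dp , mz) →
      seq (step-add refl (mark-loop nn nn (λ _ → 0) _ ≤-refl (ri M1 df dp mz))) (λ M2 (df2 , mk2) →
        seq (step-sub refl (step-set refl (emit-high _ (oi M2 df2 mk2)))) (λ M3 ti → emit-low 32 M3 (s≤s z≤n) ≤-refl ti)))
      where
        ri : ∀ M1 → Registers C M1 → Tables C nn M1 → (∀ x → x ≤ nn → M1 (F + x) ≡ 0) → Marking nn (λ _ → 0) (write M1 14 (M1 4 + M1 13))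
        ri M1 df dp mz = record
          { rdf = Registers-write 14 _ (scratch 14 _ _) df
          ; rdp = Tables-write 14 _ (≤ᵇ⇒≤ 15 34 _) (Registers.fC df) dp
          ; r14' = trans (cong₂ _+_ (Registers.f4 df) (Registers.f13 df)) (+-identityʳ nn)
          ; rj = ≤-refl
          ; rmk = λ x h → trans (write-< M1 14 _ (F + x) (small< (≤ᵇ⇒≤ 14 33 _) (≤-trans (Registers.fC df) (C≤F+ x)))) (mz x h) }
        oi : ∀ M2 → Registers C M2 → (∀ x → x ≤ nn → M2 (F + x) ≡ marks x) → Emitting (nn ∸ 1) (write (write M2 14 (M2 4 ∸ M2 2)) 29 32)
        oi M2 df mk2 = record
          { odf = Registers-write 29 _ (scratch 29 _ _) (Registers-write 14 _ (scratch 14 _ _) df)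
          ; o14 = cong₂ _∸_ (Registers.f4 df) (Registers.f2 df)
          ; o29 = refl
          ; orn = ≤-refl
          ; omk = λ x h → trans (write-< (write M2 14 _) 29 32 (F + x) (small< (≤ᵇ⇒≤ 29 33 _) F34x)) (trans (write-< M2 14 _ (F + x) (small< (≤ᵇ⇒≤ 14 33 _) F34x)) (mk2 x h))
          ; oout = λ y a b → ⊥-elim (<-irrefl refl (≤-trans a (≤-pred b))) }
          where
            F34x : ∀ {x} → 34 ≤ F + x
            F34x {x} = ≤-trans (Registers.fC df) (C≤F+ x)

module Complexity where

  open import Data.Nat
  open import Data.Nat.Properties
  open import Data.Nat.Tactic.RingSolver using (solve-∀)
  open import Data.Maybe using (just)
  open import Relation.Binary.PropositionalEquality
  open MECProgram
  open Hoare
  open PathGraph using (module Instance)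

  module Run (n' : ℕ) (c : Fin (suc n') → ℕ) where
    open Relocation n' c
    open Tabulation n' c using (tabulate; stepCost)
    open Output n' c using (output)

    time : ℕ
    time = 1 + (140 + (((nn ∸ 32) * 8 + 2) + ((6 + (nn * stepCost + 2)) +
           ((1 + (suc nn * 6 + 2)) + ((1 + (nn * 7 + 1)) + ((2 + (((nn ∸ 1) ∸ 32) * 8 + 5)) + 64))))))

    program-correct : Reach prog 0 inp 320 (Instance.OutputsMarks nn c) time
    program-correct = step-jz-suc refl refl (seq relocate λ M (C , copying) →
      seq (copy-colours C M copying) λ M₁ colours → seq (tabulate C M₁ colours) (output C))

  cost : ℕ → ℕ → ℕ → ℕ
  cost x k₁ k₂ = 10 * x * x * x + 30 * x * x + 26 * x + 8 * k₁ + 8 * k₂ + 233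

  time≡cost : ∀ x k₁ k₂ → 1 + (140 + ((k₁ * 8 + 2) + ((6 + (x * (13 + x * (30 + x * 10)) + 2)) +
              ((1 + (suc x * 6 + 2)) + ((1 + (x * 7 + 1)) + ((2 + (k₂ * 8 + 5)) + 64)))))) ≡
              10 * x * x * x + 30 * x * x + 26 * x + 8 * k₁ + 8 * k₂ + 233
  time≡cost = solve-∀

  cost-mono : ∀ x k₁ k₂ → k₁ ≤ x → k₂ ≤ x → cost x k₁ k₂ ≤ cost x x x
  cost-mono x k₁ k₂ k₁≤x k₂≤x =
    +-monoˡ-≤ 233 (+-mono-≤ (+-monoʳ-≤ (10 * x * x * x + 30 * x * x + 26 * x) (*-monoʳ-≤ 8 k₁≤x)) (*-monoʳ-≤ 8 k₂≤x))

  cost+slack : ∀ y → let x = 1 + y in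
    1 + (10 * x * x * x + 30 * x * x + 26 * x + 8 * x + 8 * x + 233) + (390 * y * y * y + 1140 * y * y + 1068 * y + 484) ≡
    400 * (x * (x * (x * 1))) + 400
  cost+slack = solve-∀

  time-bound : ∀ n' (c : Fin (suc n') → ℕ) → Run.time n' c < 400 * suc n' ^ 3 + 400
  time-bound n' c = begin
    suc (Run.time n' c)                         ≡⟨ cong suc (time≡cost (suc n') (suc n' ∸ 32) (n' ∸ 32)) ⟩
    suc (cost (suc n') (suc n' ∸ 32) (n' ∸ 32)) ≤⟨ s≤s (cost-mono (suc n') _ _ (m∸n≤m (suc n') 32) (≤-trans (m∸n≤m n' 32) (n≤1+n n'))) ⟩
    suc (cost (suc n') (suc n') (suc n'))       ≤⟨ m≤m+n _ _ ⟩
    suc (cost (suc n') (suc n') (suc n')) + _   ≡⟨ cost+slack n' ⟩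
    400 * suc n' ^ 3 + 400                      ∎
    where open ≤-Reasoning

  runs : ∀ n (c : Fin n → ℕ) →
         Σ Memory λ M → (run prog (400 * n ^ 3 + 400) 0 (pathInput n c) ≡ just M) × Instance.OutputsMarks n c M
  runs zero c = halts {P = prog} {pc = 320} {M = pathInput 0 c} {Q = Instance.OutputsMarks 0 c} {T = 1} {fuel = 400}
    refl (step-jz-zero refl refl (done λ _ ())) (s≤s (s≤s z≤n))
  runs (suc n') c = halts refl (Run.program-correct n' c) (time-bound n' c)

  solves-MEC : ∀ n (c : Fin n → ℕ) → Σ Memory λ M →
               (run prog (400 * n ^ 3 + 400) 0 (pathInput n c) ≡ just M) × OptimalMEC (pathGraph n c) (decodeRemovalFor n c M)
  solves-MEC n c with runs n c
  ... | M , ran , marked = M , ran , Instance.optimal n c M marked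

theorem10 : Σ Program λ P → Σ ℕ λ a →
    (n : ℕ) (c : Fin n → ℕ) →
    Σ Memory λ M →
    (run P (a * n ^ 3 + a) 0 (pathInput n c) ≡ just M) ×
    OptimalMEC (pathGraph n c) (decodeRemovalFor n c M)
theorem10 = MECProgram.prog , 400 , Complexity.solves-MEC
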